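{- For every integer $n\ge 0$, \[\overline{p}_3(8n+1)\equiv 0 \pmod 2,\quad \overline{p}_3(8n+2)\equiv 0\pmod 8,\quad \overline{p}_3(8n+3)\equiv 0\pmod{16},\] \[\overline{p}_3(8n+4)\equiv 0\pmod 2,\quad \overline{p}_3(8n+5)\equiv 0\pmod{16},\quad \overline{p}_3(8n+6)\equiv 0\pmod{16}.\]
   Context: An overpartition of $n$ is a partition of $n$ in which the first occurrence of each distinct part may (or may not) be overlined. An overpartition triple of $n$ is a triple of overpartitions whose parts together sum to $n$. $\overline{p}_3(n)$ denotes the number of overpartition triples of $n$, with $\overline{p}_3(0)=1$; equivalently $\sum_{n\ge0}\overline{p}_3(n)q^n=\big((-q;q)_\infty/(q;q)_\infty\big)^3$, where $(a;q)_\infty=\prod_{n\ge0}(1-aq^n)$. -}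

module Defs where

open import Data.Nat using (ℕ; zero; suc; _+_; _*_; _∸_; _≤ᵇ_)
open import Data.Bool using (if_then_else_)
open import Data.List using (List; map; upTo)
open import Data.Nat.ListAction using (sum)

-- ovp k n = number of overpartitions of n all of whose parts are ≤ k.
-- Recurrence on the largest allowed part size s = suc k: either s does not
-- occur (ovp k n), or s occurs with multiplicity m ≥ 1 (m * s ≤ n), in which
-- case its first occurrence is overlined or not (factor 2) and the remaining
-- parts form an overpartition of n ∸ m * s with parts ≤ k.
ovp : ℕ → ℕ → ℕ
ovp zero zero = 1
ovp zero (suc n) = 0
ovp (suc k) n =
  ovp k n + 2 * sum (map (λ i → let m = suc i in
                              if m * suc k ≤ᵇ n then ovp k (n ∸ m * suc k) else 0)
                         (upTo n))

overlinep : ℕ → ℕ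
overlinep n = ovp n n

overlinep3 : ℕ → ℕ
overlinep3 n =
  sum (map (λ a → sum (map (λ b → overlinep a * overlinep b * overlinep ((n ∸ a) ∸ b))
                           (upTo (suc (n ∸ a)))))
           (upTo (suc n)))

module Submission where

-- P̄ = (-q;q)∞/(q;q)∞ is the reciprocal of θ = 1 + 2b with b = Σ_{j ≥ 1} (-1)^j q^(j²) (Gauss).
-- Since (1 + 2b)(1 - 2b + 4b² - 8b³) = 1 - 16b⁴, modulo 16 we have P̄³ ≡ (1 - 2b + 4b² - 8b³)³
-- ≡ 1 - 6b + 8b², and b² ≡ Σ_{j ≥ 1} q^(2j²) modulo 2.  Hence for N ≥ 1, p̄₃(N) ≡ -6 b_N + 8 s_N
-- (mod 16), where b_N vanishes unless N is a square and s_N unless N is twice a square; squares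
-- are 0, 1, 4 and twice squares 0, 2 modulo 8.
-- Gauss's identity is proved modulo q^(2n+1) from finite products: the finite Jacobi triple
-- product Σ_{k ≤ 2n} (-1)^k q^((k-n)²) [2n, k]_{q²} = (-1)^n (q;q²)_n², obtained from a q-Pascal
-- recurrence in n, gives θ ≡ (q²;q²)_n (q;q²)_n²; together with (q;q)_2n = (q;q²)_n (q²;q²)_n,
-- (q;q)_m (-q;q)_m = (q²;q²)_m and (q;q)_k P̄_{≤k} = (-q;q)_k, where P̄_{≤k} counts overpartitions
-- with parts ≤ k, this yields θ P̄ ≡ 1.

module PowerSeries where

  open import Data.Nat.Base as ℕ using (ℕ; zero; suc; _≤_; _<_; z≤n; s≤s)
  import Data.Nat.Properties as ℕ
  open import Data.Integer.Base using (ℤ; 0ℤ; 1ℤ; _+_; _*_; -_)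
  import Data.Integer.Properties as ℤ
  open import Data.Integer.Tactic.RingSolver using (solve-∀)
  open import Data.Product.Base using (_,_)
  open import Data.Maybe.Base using (Maybe; just; nothing)
  open import Relation.Nullary.Decidable.Core using (yes; no)
  open import Algebra.Bundles using (CommutativeRing)
  open import Algebra.Structures using (IsCommutativeRing)
  import Algebra.Solver.Ring.AlmostCommutativeRing as ACR
  open import Relation.Binary.PropositionalEquality
  import Relation.Binary.Reasoning.Setoid as SetoidReasoning

  Series : Set
  Series = ℕ → ℤ

  infix 4 _≈_
  _≈_ : Series → Series → Set
  f ≈ g = ∀ n → f n ≡ g n

  ≈-refl : ∀ {f} → f ≈ f
  ≈-refl _ = refl

  ≈-sym : ∀ {f g} → f ≈ g → g ≈ f
  ≈-sym p n = sym (p n)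

  ≈-trans : ∀ {f g h} → f ≈ g → g ≈ h → f ≈ h
  ≈-trans p q n = trans (p n) (q n)

  tail : Series → Series
  tail f n = f (suc n)

  const : ℤ → Series
  const c zero    = c
  const c (suc _) = 0ℤ

  𝟘 𝟙 : Series
  𝟘 = const 0ℤ
  𝟙 = const 1ℤ

  𝟘-coeff : ∀ n → 𝟘 n ≡ 0ℤ
  𝟘-coeff zero    = refl
  𝟘-coeff (suc n) = refl

  infixl 6 _⊕_ _⊖_
  infixl 7 _⊛_ _·_
  infix  8 ⊝_

  _⊕_ : Series → Series → Series
  (f ⊕ g) n = f n + g n

  ⊝_ : Series → Series
  (⊝ f) n = - f n

  _⊖_ : Series → Series → Series
  f ⊖ g = f ⊕ ⊝ g

  _·_ : ℤ → Series → Series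
  (c · f) n = c * f n

  _⊛_ : Series → Series → Series
  (f ⊛ g) zero    = f 0 * g 0
  (f ⊛ g) (suc n) = f 0 * g (suc n) + (tail f ⊛ g) n

  infixr 8 _^_
  _^_ : Series → ℕ → Series
  f ^ zero  = 𝟙
  f ^ suc n = f ⊛ f ^ n

  ⊕-cong : ∀ {f f′ g g′} → f ≈ f′ → g ≈ g′ → f ⊕ g ≈ f′ ⊕ g′
  ⊕-cong p q n = cong₂ _+_ (p n) (q n)

  ⊝-cong : ∀ {f f′} → f ≈ f′ → ⊝ f ≈ ⊝ f′
  ⊝-cong p n = cong -_ (p n)

  ⊛-cong : ∀ {f f′ g g′} → f ≈ f′ → g ≈ g′ → f ⊛ g ≈ f′ ⊛ g′
  ⊛-cong p q zero    = cong₂ _*_ (p 0) (q 0)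
  ⊛-cong p q (suc n) = cong₂ _+_ (cong₂ _*_ (p 0) (q (suc n))) (⊛-cong (λ i → p (suc i)) q n)

  ⊛-vanishˡ : ∀ {f} g n → (∀ i → i ≤ n → f i ≡ 0ℤ) → (f ⊛ g) n ≡ 0ℤ
  ⊛-vanishˡ {f} g zero    f≡0 rewrite f≡0 0 z≤n = refl
  ⊛-vanishˡ {f} g (suc n) f≡0
    rewrite f≡0 0 z≤n | ⊛-vanishˡ {tail f} g n (λ i i≤n → f≡0 (suc i) (s≤s i≤n)) = refl

  ⊛-end : ∀ f g n → (f ⊛ g) (suc n) ≡ (f ⊛ tail g) n + f (suc n) * g 0
  ⊛-end f g zero    = refl
  ⊛-end f g (suc n) = trans (cong (λ z → f 0 * g (suc (suc n)) + z) (⊛-end (tail f) g n))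
                            (sym (ℤ.+-assoc (f 0 * g (suc (suc n))) ((tail f ⊛ tail g) n) (f (suc (suc n)) * g 0)))

  ⊛-comm : ∀ f g → f ⊛ g ≈ g ⊛ f
  ⊛-comm f g zero    = ℤ.*-comm (f 0) (g 0)
  ⊛-comm f g (suc n) rewrite ⊛-end g f n | ⊛-comm (tail f) g n =
    trans (ℤ.+-comm (f 0 * g (suc n)) ((g ⊛ tail f) n))
          (cong (λ z → (g ⊛ tail f) n + z) (ℤ.*-comm (f 0) (g (suc n))))

  ⊛-distribʳ : ∀ f g h → (f ⊕ g) ⊛ h ≈ f ⊛ h ⊕ g ⊛ h
  ⊛-distribʳ f g h zero    = ℤ.*-distribʳ-+ (h 0) (f 0) (g 0)
  ⊛-distribʳ f g h (suc n)
    rewrite ⊛-distribʳ (tail f) (tail g) h n | ℤ.*-distribʳ-+ (h (suc n)) (f 0) (g 0) =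
    interchange (f 0 * h (suc n)) (g 0 * h (suc n)) ((tail f ⊛ h) n) ((tail g ⊛ h) n)
    where
    interchange : ∀ a b c d → a + b + (c + d) ≡ a + c + (b + d)
    interchange = solve-∀

  ·-⊛ : ∀ c f g → c · f ⊛ g ≈ c · (f ⊛ g)
  ·-⊛ c f g zero    = ℤ.*-assoc c (f 0) (g 0)
  ·-⊛ c f g (suc n) rewrite ·-⊛ c (tail f) g n | ℤ.*-assoc c (f 0) (g (suc n)) =
    sym (ℤ.*-distribˡ-+ c (f 0 * g (suc n)) ((tail f ⊛ g) n))

  -- The rewrites below match because tail (f ⊛ g) is definitionally f 0 · tail g ⊕ tail f ⊛ g.
  ⊛-assoc : ∀ f g h → (f ⊛ g) ⊛ h ≈ f ⊛ (g ⊛ h)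
  ⊛-assoc f g h zero    = ℤ.*-assoc (f 0) (g 0) (h 0)
  ⊛-assoc f g h (suc n)
    rewrite ⊛-distribʳ (f 0 · tail g) (tail f ⊛ g) h n | ·-⊛ (f 0) (tail g) h n
          | ⊛-assoc (tail f) g h n =
    regroup (f 0) (g 0) (h (suc n)) ((tail g ⊛ h) n) ((tail f ⊛ (g ⊛ h)) n)
    where
    regroup : ∀ a b c d e → a * b * c + (a * d + e) ≡ a * (b * c + d) + e
    regroup = solve-∀

  ⊛-identityˡ : ∀ g → 𝟙 ⊛ g ≈ g
  ⊛-identityˡ g zero    = ℤ.*-identityˡ (g 0)
  ⊛-identityˡ g (suc n) =
    trans (cong₂ _+_ (ℤ.*-identityˡ (g (suc n))) (⊛-vanishˡ g n (λ _ _ → refl)))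
          (ℤ.+-identityʳ (g (suc n)))

  ⊛-isCommutativeRing : IsCommutativeRing _≈_ _⊕_ _⊛_ ⊝_ 𝟘 𝟙
  ⊛-isCommutativeRing = record
    { isRing = record
      { +-isAbelianGroup = record
        { isGroup = record
          { isMonoid = record
            { isSemigroup = record
              { isMagma = record
                { isEquivalence = record { refl = ≈-refl ; sym = ≈-sym ; trans = ≈-trans }
                ; ∙-cong = ⊕-cong }
              ; assoc = λ f g h n → ℤ.+-assoc (f n) (g n) (h n) }
            ; identity = (λ f n → trans (cong (_+ f n) (𝟘-coeff n)) (ℤ.+-identityˡ (f n)))
                       , (λ f n → trans (cong (λ z → f n + z) (𝟘-coeff n)) (ℤ.+-identityʳ (f n))) }
          ; inverse = (λ f n → trans (ℤ.+-inverseˡ (f n)) (sym (𝟘-coeff n)))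
                    , (λ f n → trans (ℤ.+-inverseʳ (f n)) (sym (𝟘-coeff n)))
          ; ⁻¹-cong = ⊝-cong }
        ; comm = λ f g n → ℤ.+-comm (f n) (g n) }
      ; *-cong = ⊛-cong
      ; *-assoc = ⊛-assoc
      ; *-identity = ⊛-identityˡ , (λ g → ≈-trans (⊛-comm g 𝟙) (⊛-identityˡ g))
      ; distrib = (λ f g h → ≈-trans (⊛-comm f (g ⊕ h))
                               (≈-trans (⊛-distribʳ g h f) (⊕-cong (⊛-comm g f) (⊛-comm h f))))
                , (λ f g h → ⊛-distribʳ g h f) }
    ; *-comm = ⊛-comm }

  seriesRing : CommutativeRing _ _
  seriesRing = record { isCommutativeRing = ⊛-isCommutativeRing }

  module ≈-Reasoning = SetoidReasoning (CommutativeRing.setoid seriesRing)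

  open CommutativeRing seriesRing public using () renaming (*-congˡ to ⊛-congˡ; *-congʳ to ⊛-congʳ)

  ⊕-congˡ : ∀ f {g g′} → g ≈ g′ → f ⊕ g ≈ f ⊕ g′
  ⊕-congˡ f = ⊕-cong (≈-refl {f})

  ⊕-congʳ : ∀ {f f′} g → f ≈ f′ → f ⊕ g ≈ f′ ⊕ g
  ⊕-congʳ g p = ⊕-cong p (≈-refl {g})

  const-⊛ : ∀ a b → const (a * b) ≈ const a ⊛ const b
  const-⊛ a b zero    = refl
  const-⊛ a b (suc n) rewrite ℤ.*-zeroʳ a | ⊛-vanishˡ (const b) n (λ _ _ → refl) = refl

  constHomomorphism : ACR._-Raw-AlmostCommutative⟶_
                        (CommutativeRing.rawRing ℤ.+-*-commutativeRing)
                        (ACR.fromCommutativeRing seriesRing)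
  constHomomorphism = record
    { ⟦_⟧    = const
    ; +-homo = λ a b → λ { zero → refl ; (suc n) → refl }
    ; *-homo = const-⊛
    ; -‿homo = λ a → λ { zero → refl ; (suc n) → refl }
    ; 0-homo = λ _ → refl
    ; 1-homo = λ _ → refl }

  const-≟ : ∀ a b → Maybe (const a ≈ const b)
  const-≟ a b with a ℤ.≟ b
  ... | yes refl = just ≈-refl
  ... | no _     = nothing

  open import Algebra.Solver.Ring (CommutativeRing.rawRing ℤ.+-*-commutativeRing)
    (ACR.fromCommutativeRing seriesRing) constHomomorphism const-≟ public


  shift : ℕ → Series → Series
  shift zero    f         = f
  shift (suc a) f zero    = 0ℤ
  shift (suc a) f (suc n) = shift a f n

  X : ℕ → Series
  X a = shift a 𝟙

  shift-≥ : ∀ a f {n} → a ≤ n → shift a f n ≡ f (n ℕ.∸ a)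
  shift-≥ zero    f _         = refl
  shift-≥ (suc a) f (s≤s a≤n) = shift-≥ a f a≤n

  shift-< : ∀ a f {n} → n < a → shift a f n ≡ 0ℤ
  shift-< (suc a) f {zero}  _         = refl
  shift-< (suc a) f {suc n} (s≤s n<a) = shift-< a f n<a

  X-⊛ : ∀ a f → X a ⊛ f ≈ shift a f
  X-⊛ zero    f         = ⊛-identityˡ f
  X-⊛ (suc a) f zero    = ℤ.*-zeroˡ (f 0)
  X-⊛ (suc a) f (suc n) = trans (cong (_+ (X a ⊛ f) n) (ℤ.*-zeroˡ (f (suc n))))
                                (trans (ℤ.+-identityˡ _) (X-⊛ a f n))

  shift-shift : ∀ a b f → shift a (shift b f) ≈ shift (a ℕ.+ b) f
  shift-shift zero    b f n       = refl
  shift-shift (suc a) b f zero    = refl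
  shift-shift (suc a) b f (suc n) = shift-shift a b f n

  X-+ : ∀ a b → X a ⊛ X b ≈ X (a ℕ.+ b)
  X-+ a b = ≈-trans (X-⊛ a (X b)) (shift-shift a b 𝟙)

  X-+-≡ : ∀ a b {c} → a ℕ.+ b ≡ c → X a ⊛ X b ≈ X c
  X-+-≡ a b refl = X-+ a b

module Truncation where

  open import Data.Nat.Base as ℕ using (ℕ; zero; suc; _≤_; _<_; z≤n; s≤s)
  import Data.Nat.Properties as ℕ
  open import Data.Sum.Base using (inj₁; inj₂)
  open import Data.Integer.Base using (0ℤ; 1ℤ; _+_; _*_; -_; _-_)
  import Data.Integer.Properties as ℤ
  open import Relation.Binary.PropositionalEquality
  open import Relation.Binary.Bundles using (Setoid)
  import Relation.Binary.Reasoning.Setoid as SetoidReasoning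
  open PowerSeries

  infix 4 _≈[_]_
  _≈[_]_ : Series → ℕ → Series → Set
  f ≈[ M ] g = ∀ i → i < M → f i ≡ g i

  ≈⇒≈[] : ∀ {f g} M → f ≈ g → f ≈[ M ] g
  ≈⇒≈[] M p i _ = p i

  ≈[]-refl : ∀ {f} M → f ≈[ M ] f
  ≈[]-refl M i _ = refl

  ≈[]-sym : ∀ {f g} M → f ≈[ M ] g → g ≈[ M ] f
  ≈[]-sym M p i i<M = sym (p i i<M)

  ≈[]-trans : ∀ {f g h} M → f ≈[ M ] g → g ≈[ M ] h → f ≈[ M ] h
  ≈[]-trans M p q i i<M = trans (p i i<M) (q i i<M)

  ≈[]-weaken : ∀ {f g M K} → K ≤ M → f ≈[ M ] g → f ≈[ K ] g
  ≈[]-weaken K≤M p i i<K = p i (ℕ.<-≤-trans i<K K≤M)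

  ≈[]-extend : ∀ {f g} M → f ≈[ M ] g → f M ≡ g M → f ≈[ suc M ] g
  ≈[]-extend M p q i i<1+M with ℕ.m≤n⇒m<n∨m≡n (ℕ.≤-pred i<1+M)
  ... | inj₁ i<M  = p i i<M
  ... | inj₂ refl = q

  ≈[]-setoid : ℕ → Setoid _ _
  ≈[]-setoid M = record
    { Carrier       = Series
    ; _≈_           = _≈[ M ]_
    ; isEquivalence = record { refl = ≈[]-refl M ; sym = ≈[]-sym M ; trans = ≈[]-trans M } }

  module ≈[]-Reasoning (M : ℕ) = SetoidReasoning (≈[]-setoid M)

  ⊕-cong[] : ∀ {f f′ g g′} M → f ≈[ M ] f′ → g ≈[ M ] g′ → f ⊕ g ≈[ M ] f′ ⊕ g′
  ⊕-cong[] M p q i i<M = cong₂ _+_ (p i i<M) (q i i<M)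

  ⊝-cong[] : ∀ {f f′} M → f ≈[ M ] f′ → ⊝ f ≈[ M ] ⊝ f′
  ⊝-cong[] M p i i<M = cong -_ (p i i<M)

  ⊛-local : ∀ {f f′ g g′} n → f ≈[ suc n ] f′ → g ≈[ suc n ] g′ → (f ⊛ g) n ≡ (f′ ⊛ g′) n
  ⊛-local zero    p q = cong₂ _*_ (p 0 (s≤s z≤n)) (q 0 (s≤s z≤n))
  ⊛-local (suc n) p q = cong₂ _+_ (cong₂ _*_ (p 0 (s≤s z≤n)) (q (suc n) ℕ.≤-refl))
                                  (⊛-local n (λ i i<n → p (suc i) (s≤s i<n)) (≈[]-weaken (ℕ.n≤1+n _) q))

  ⊛-cong[] : ∀ {f f′ g g′} M → f ≈[ M ] f′ → g ≈[ M ] g′ → f ⊛ g ≈[ M ] f′ ⊛ g′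
  ⊛-cong[] M p q i i<M = ⊛-local i (≈[]-weaken i<M p) (≈[]-weaken i<M q)

  shift-cong[] : ∀ a {f g} M → f ≈[ M ] g → shift a f ≈[ a ℕ.+ M ] shift a g
  shift-cong[] zero    M p                   = p
  shift-cong[] (suc a) M p zero    _         = refl
  shift-cong[] (suc a) M p (suc i) (s≤s i<M) = shift-cong[] a M p i i<M

  shift≈[]𝟘 : ∀ a f → shift a f ≈[ a ] 𝟘
  shift≈[]𝟘 (suc a) f zero    _         = refl
  shift≈[]𝟘 (suc a) f (suc i) (s≤s i<a) = trans (shift≈[]𝟘 a f i i<a) (𝟘-coeff i)

  ⊛-leading : ∀ h u k → h ≈[ k ] 𝟘 → (h ⊛ u) k ≡ h k * u 0
  ⊛-leading h u zero    _   = refl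
  ⊛-leading h u (suc j) h≈0 = begin
    (h ⊛ u) (suc j)                       ≡⟨ ⊛-end h u j ⟩
    (h ⊛ tail u) j + h (suc j) * u 0      ≡⟨ cong (_+ h (suc j) * u 0) (⊛-vanishˡ (tail u) j h≡0) ⟩
    0ℤ + h (suc j) * u 0                  ≡⟨ ℤ.+-identityˡ _ ⟩
    h (suc j) * u 0                       ∎
    where
    open ≡-Reasoning
    h≡0 : ∀ i → i ≤ j → h i ≡ 0ℤ
    h≡0 i i≤j = trans (h≈0 i (s≤s i≤j)) (𝟘-coeff i)

  ⊛-unit≈[]𝟘 : ∀ {h u} M → u 0 ≡ 1ℤ → h ⊛ u ≈[ M ] 𝟘 → h ≈[ M ] 𝟘
  ⊛-unit≈[]𝟘 zero _ _ i ()
  ⊛-unit≈[]𝟘 {h} {u} (suc M) u₀≡1 hu≈0 = ≈[]-extend M h≈0 (begin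
    h M            ≡⟨ sym (ℤ.*-identityʳ (h M)) ⟩
    h M * 1ℤ       ≡⟨ cong (h M *_) (sym u₀≡1) ⟩
    h M * u 0      ≡⟨ sym (⊛-leading h u M h≈0) ⟩
    (h ⊛ u) M      ≡⟨ hu≈0 M ℕ.≤-refl ⟩
    𝟘 M            ∎)
    where
    open ≡-Reasoning
    h≈0 : h ≈[ M ] 𝟘
    h≈0 = ⊛-unit≈[]𝟘 M u₀≡1 (≈[]-weaken (ℕ.n≤1+n M) hu≈0)

  ⊛-cancelʳ[] : ∀ {f g} u M → u 0 ≡ 1ℤ → f ⊛ u ≈[ M ] g ⊛ u → f ≈[ M ] g
  ⊛-cancelʳ[] {f} {g} u M u₀≡1 fu≈gu i i<M =
    ℤ.i-j≡0⇒i≡j (f i) (g i) (trans (⊛-unit≈[]𝟘 M u₀≡1 difference i i<M) (𝟘-coeff i))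
    where
    difference : (f ⊕ ⊝ g) ⊛ u ≈[ M ] 𝟘
    difference j j<M = begin
      ((f ⊕ ⊝ g) ⊛ u) j       ≡⟨ solve 3 (λ f g u → (f :- g) :* u := f :* u :- g :* u) ≈-refl f g u j ⟩
      (f ⊛ u) j - (g ⊛ u) j   ≡⟨ cong (_- (g ⊛ u) j) (fu≈gu j j<M) ⟩
      (g ⊛ u) j - (g ⊛ u) j   ≡⟨ ℤ.+-inverseʳ ((g ⊛ u) j) ⟩
      0ℤ                      ≡⟨ 𝟘-coeff j ⟨
      𝟘 j                     ∎
      where open ≡-Reasoning

  ⊛-cancelʳ : ∀ {f g} u → u 0 ≡ 1ℤ → f ⊛ u ≈ g ⊛ u → f ≈ g
  ⊛-cancelʳ u u₀≡1 fu≈gu n = ⊛-cancelʳ[] u (suc n) u₀≡1 (≈⇒≈[] (suc n) fu≈gu) n ℕ.≤-refl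

module AlternatingSums where

  open import Data.Nat.Base as ℕ using (ℕ; zero; suc; _<_; z≤n; s≤s)
  import Data.Nat.Properties as ℕ
  open import Data.Integer.Base using (0ℤ; 1ℤ)
  open import Relation.Binary.PropositionalEquality
  open PowerSeries
  open Truncation

  altSum : (ℕ → Series) → ℕ → Series
  altSum f zero    = 𝟘
  altSum f (suc L) = f 0 ⊖ altSum (λ k → f (suc k)) L

  altSum-cong : ∀ {f g} L → (∀ k → f k ≈ g k) → altSum f L ≈ altSum g L
  altSum-cong zero    f≈g = ≈-refl
  altSum-cong (suc L) f≈g = ⊕-cong (f≈g 0) (⊝-cong (altSum-cong L (λ k → f≈g (suc k))))

  altSum-⊕ : ∀ f g L → altSum (λ k → f k ⊕ g k) L ≈ altSum f L ⊕ altSum g L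
  altSum-⊕ f g zero    = solve 0 (con 0ℤ := con 0ℤ :+ con 0ℤ) ≈-refl
  altSum-⊕ f g (suc L) = begin
    (f 0 ⊕ g 0) ⊖ altSum (λ k → f (suc k) ⊕ g (suc k)) L
      ≈⟨ ⊕-congˡ (f 0 ⊕ g 0) (⊝-cong (altSum-⊕ (λ k → f (suc k)) (λ k → g (suc k)) L)) ⟩
    (f 0 ⊕ g 0) ⊖ (altSum (λ k → f (suc k)) L ⊕ altSum (λ k → g (suc k)) L)
      ≈⟨ solve 4 (λ a b c d → (a :+ b) :- (c :+ d) := (a :- c) :+ (b :- d)) ≈-refl
                 (f 0) (g 0) (altSum (λ k → f (suc k)) L) (altSum (λ k → g (suc k)) L) ⟩
    (f 0 ⊖ altSum (λ k → f (suc k)) L) ⊕ (g 0 ⊖ altSum (λ k → g (suc k)) L) ∎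
    where open ≈-Reasoning

  altSum-⊛ : ∀ a f L → altSum (λ k → a ⊛ f k) L ≈ a ⊛ altSum f L
  altSum-⊛ a f zero    = solve 1 (λ a → con 0ℤ := a :* con 0ℤ) ≈-refl a
  altSum-⊛ a f (suc L) = begin
    a ⊛ f 0 ⊖ altSum (λ k → a ⊛ f (suc k)) L
      ≈⟨ ⊕-congˡ (a ⊛ f 0) (⊝-cong (altSum-⊛ a (λ k → f (suc k)) L)) ⟩
    a ⊛ f 0 ⊖ a ⊛ altSum (λ k → f (suc k)) L
      ≈⟨ solve 3 (λ a b c → a :* b :- a :* c := a :* (b :- c)) ≈-refl a (f 0) (altSum (λ k → f (suc k)) L) ⟩
    a ⊛ (f 0 ⊖ altSum (λ k → f (suc k)) L) ∎
    where open ≈-Reasoning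

  sign : ℕ → Series
  sign zero    = 𝟙
  sign (suc n) = ⊝ sign n

  sign-square : ∀ n → sign n ⊛ sign n ≈ 𝟙
  sign-square zero    = solve 0 (con 1ℤ :* con 1ℤ := con 1ℤ) ≈-refl
  sign-square (suc n) = ≈-trans (solve 1 (λ s → (:- s) :* (:- s) := s :* s) ≈-refl (sign n)) (sign-square n)

  altSum-snoc : ∀ f L → altSum f (suc L) ≈ altSum f L ⊕ sign L ⊛ f L
  altSum-snoc f zero    = solve 1 (λ a → a :- con 0ℤ := con 0ℤ :+ con 1ℤ :* a) ≈-refl (f 0)
  altSum-snoc f (suc L) = begin
    f 0 ⊖ altSum (λ k → f (suc k)) (suc L)
      ≈⟨ ⊕-congˡ (f 0) (⊝-cong (altSum-snoc (λ k → f (suc k)) L)) ⟩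
    f 0 ⊖ (altSum (λ k → f (suc k)) L ⊕ sign L ⊛ f (suc L))
      ≈⟨ solve 4 (λ a b s c → a :- (b :+ s :* c) := (a :- b) :+ (:- s) :* c) ≈-refl
                 (f 0) (altSum (λ k → f (suc k)) L) (sign L) (f (suc L)) ⟩
    (f 0 ⊖ altSum (λ k → f (suc k)) L) ⊕ ⊝ sign L ⊛ f (suc L) ∎
    where open ≈-Reasoning

  altSum-tail : ∀ f L → f L ≈ 𝟘 → altSum (λ k → f (suc k)) L ≈ f 0 ⊖ altSum f L
  altSum-tail f L fL≈0 = begin
    T                                    ≈⟨ solve 2 (λ a t → t := a :- (a :- t)) ≈-refl (f 0) T ⟩
    f 0 ⊖ altSum f (suc L)               ≈⟨ ⊕-congˡ (f 0) (⊝-cong (altSum-snoc f L)) ⟩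
    f 0 ⊖ (altSum f L ⊕ sign L ⊛ f L)    ≈⟨ ⊕-congˡ (f 0) (⊝-cong (⊕-congˡ (altSum f L) (⊛-congˡ fL≈0))) ⟩
    f 0 ⊖ (altSum f L ⊕ sign L ⊛ 𝟘)      ≈⟨ solve 3 (λ a b s → a :- (b :+ s :* con 0ℤ) := a :- b) ≈-refl
                                                  (f 0) (altSum f L) (sign L) ⟩
    f 0 ⊖ altSum f L                     ∎
    where
    open ≈-Reasoning
    T : Series
    T = altSum (λ k → f (suc k)) L

  sign-tail : ∀ j i → sign j (suc i) ≡ 0ℤ
  sign-tail zero    i = refl
  sign-tail (suc j) i rewrite sign-tail j i = refl

  sign-even : ∀ n → sign (n ℕ.+ n) ≈ 𝟙
  sign-even zero    = ≈-refl
  sign-even (suc n) = begin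
    ⊝ sign (n ℕ.+ suc n)        ≡⟨ cong (λ m → ⊝ sign m) (ℕ.+-suc n n) ⟩
    ⊝ ⊝ sign (n ℕ.+ n)          ≈⟨ solve 1 (λ s → :- (:- s) := s) ≈-refl (sign (n ℕ.+ n)) ⟩
    sign (n ℕ.+ n)              ≈⟨ sign-even n ⟩
    𝟙                           ∎
    where open ≈-Reasoning

  altSum-cong[] : ∀ {f g} L M → (∀ k → k < L → f k ≈[ M ] g k) → altSum f L ≈[ M ] altSum g L
  altSum-cong[] zero    M f≈g = ≈[]-refl M
  altSum-cong[] (suc L) M f≈g =
    ⊕-cong[] M (f≈g 0 (s≤s z≤n)) (⊝-cong[] M (altSum-cong[] L M (λ k k<L → f≈g (suc k) (s≤s k<L))))

module ApplyUpToSums where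

  open import Data.Nat.Base using (zero; suc; _+_; _*_; _≤_; _<_; z≤n; s≤s)
  open import Data.Nat.Properties using (*-zeroʳ; *-distribˡ-+)
  open import Data.Nat.ListAction using (sum)
  open import Data.List.Base using (applyUpTo)
  open import Relation.Binary.PropositionalEquality

  sum-applyUpTo-cong : ∀ f g n → (∀ i → i < n → f i ≡ g i) → sum (applyUpTo f n) ≡ sum (applyUpTo g n)
  sum-applyUpTo-cong f g zero    f≗g = refl
  sum-applyUpTo-cong f g (suc n) f≗g =
    cong₂ _+_ (f≗g 0 (s≤s z≤n)) (sum-applyUpTo-cong _ _ n (λ i i<n → f≗g (suc i) (s≤s i<n)))

  sum-applyUpTo-truncate : ∀ f m n → m ≤ n → (∀ i → m ≤ i → f i ≡ 0) →
                           sum (applyUpTo f n) ≡ sum (applyUpTo f m)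
  sum-applyUpTo-truncate f zero    zero    _         _   = refl
  sum-applyUpTo-truncate f zero    (suc n) _         f≡0 =
    cong₂ _+_ (f≡0 0 z≤n) (sum-applyUpTo-truncate _ 0 n z≤n (λ i _ → f≡0 (suc i) z≤n))
  sum-applyUpTo-truncate f (suc m) (suc n) (s≤s m≤n) f≡0 =
    cong (f 0 +_) (sum-applyUpTo-truncate _ m n m≤n (λ i m≤i → f≡0 (suc i) (s≤s m≤i)))

  sum-applyUpTo-scale : ∀ c h k → sum (applyUpTo (λ i → c * h i) k) ≡ c * sum (applyUpTo h k)
  sum-applyUpTo-scale c h zero    = sym (*-zeroʳ c)
  sum-applyUpTo-scale c h (suc k) = trans (cong (c * h 0 +_) (sum-applyUpTo-scale c (λ i → h (suc i)) k))
                                          (sym (*-distribˡ-+ c (h 0) (sum (applyUpTo (λ i → h (suc i)) k))))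

module OverpartitionRecurrence where

  open import Data.Nat.Base using (ℕ; zero; suc; _+_; _*_; _∸_; _≤_; _<_; _≤ᵇ_; z≤n; s≤s)
  open import Data.Nat.Properties
  open import Data.Nat.Tactic.RingSolver using (solve-∀)
  open import Data.Nat.ListAction using (sum)
  open import Data.Bool.Base using (true; false; if_then_else_; T)
  open import Data.List.Base using (applyUpTo)
  open import Data.List.Properties using (map-applyUpTo)
  open import Data.Unit.Base using (tt)
  open import Function.Base using (id)
  open import Relation.Nullary.Decidable.Core using (yes; no)
  open import Relation.Nullary.Negation.Core using (contradiction)
  open import Relation.Binary.PropositionalEquality
  open import Defs
  open ApplyUpToSums

  -- The summand of the recurrence defining ovp (suc k) n, as a function of the total size a of
  -- the removed parts equal to suc k.
  remainder : ℕ → ℕ → ℕ → ℕ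
  remainder k n a = if a ≤ᵇ n then ovp k (n ∸ a) else 0

  remainder-≤ : ∀ k {n a} → a ≤ n → remainder k n a ≡ ovp k (n ∸ a)
  remainder-≤ k {n} {a} a≤n with a ≤ᵇ n | ≤⇒≤ᵇ a≤n
  ... | true | _ = refl

  remainder-> : ∀ k {n a} → n < a → remainder k n a ≡ 0
  remainder-> k {n} {a} n<a with a ≤ᵇ n in eq
  ... | false = refl
  ... | true  = contradiction (≤ᵇ⇒≤ a n (subst T (sym eq) tt)) (<⇒≱ n<a)

  remainder-+ : ∀ k {n} s a → s ≤ n → remainder k n (s + a) ≡ remainder k (n ∸ s) a
  remainder-+ k {n} s a s≤n with a ≤? n ∸ s
  ... | yes a≤n∸s = begin
    remainder k n (s + a)  ≡⟨ remainder-≤ k (subst (_≤ n) (+-comm a s) (m≤o∸n⇒m+n≤o a s≤n a≤n∸s)) ⟩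
    ovp k (n ∸ (s + a))    ≡⟨ cong (ovp k) (sym (∸-+-assoc n s a)) ⟩
    ovp k (n ∸ s ∸ a)      ≡⟨ remainder-≤ k a≤n∸s ⟨
    remainder k (n ∸ s) a  ∎
    where open ≡-Reasoning
  ... | no a≰n∸s = trans (remainder-> k n<s+a) (sym (remainder-> k (≰⇒> a≰n∸s)))
    where
    n<s+a : n < s + a
    n<s+a = subst (_< s + a) (m+[n∸m]≡n s≤n) (+-monoʳ-< s (≰⇒> a≰n∸s))

  copies : ℕ → ℕ → ℕ
  copies k n = sum (applyUpTo (λ i → remainder k n (suc i * suc k)) n)

  ovp-suc : ∀ k n → ovp (suc k) n ≡ ovp k n + 2 * copies k n
  ovp-suc k n = cong (λ c → ovp k n + 2 * sum c) (map-applyUpTo id (λ i → remainder k n (suc i * suc k)) n)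

  copies-small : ∀ k n → n < suc k → copies k n ≡ 0
  copies-small k n n<1+k = sum-applyUpTo-truncate _ 0 n z≤n
    (λ i _ → remainder-> k (<-≤-trans n<1+k (m≤n*m (suc k) (suc i))))

  copies-large : ∀ k n → suc k ≤ n → copies k n ≡ ovp k (n ∸ suc k) + copies k (n ∸ suc k)
  copies-large k (suc n) k<1+n = cong₂ _+_ first rest
    where
    first : remainder k (suc n) (suc k + 0) ≡ ovp k (suc n ∸ suc k)
    first = trans (remainder-≤ k (subst (_≤ suc n) (sym (+-identityʳ (suc k))) k<1+n))
                  (cong (λ a → ovp k (suc n ∸ a)) (+-identityʳ (suc k)))
    rest : sum (applyUpTo (λ i → remainder k (suc n) (suc (suc i) * suc k)) n) ≡ copies k (n ∸ k)
    rest = begin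
      sum (applyUpTo (λ i → remainder k (suc n) (suc k + suc i * suc k)) n)
        ≡⟨ sum-applyUpTo-cong _ _ n (λ i _ → remainder-+ k (suc k) (suc i * suc k) k<1+n) ⟩
      sum (applyUpTo (λ i → remainder k (n ∸ k) (suc i * suc k)) n)
        ≡⟨ sum-applyUpTo-truncate _ (n ∸ k) n (m∸n≤m n k)
             (λ i n∸k≤i → remainder-> k (s≤s (≤-trans n∸k≤i (≤-trans (m≤m*n i (suc k)) (m≤n+m _ k))))) ⟩
      copies k (n ∸ k) ∎
      where open ≡-Reasoning

  ovp-suc-small : ∀ k n → n < suc k → ovp (suc k) n ≡ ovp k n
  ovp-suc-small k n n<1+k rewrite ovp-suc k n | copies-small k n n<1+k = +-identityʳ (ovp k n)

  ovp-suc-large : ∀ k n → suc k ≤ n →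
                  ovp (suc k) n ≡ ovp k n + ovp k (n ∸ suc k) + ovp (suc k) (n ∸ suc k)
  ovp-suc-large k n k<n rewrite ovp-suc k n | copies-large k n k<n | ovp-suc k (n ∸ suc k) =
    regroup (ovp k n) (ovp k (n ∸ suc k)) (copies k (n ∸ suc k))
    where
    regroup : ∀ x a c → x + 2 * (a + c) ≡ x + a + (a + 2 * c)
    regroup = solve-∀

  ovp-stable : ∀ d n → ovp (d + n) n ≡ overlinep n
  ovp-stable zero    n = refl
  ovp-stable (suc d) n = trans (ovp-suc-small (d + n) n (s≤s (m≤n+m n d))) (ovp-stable d n)

module OverpartitionSeries where

  open import Data.Nat.Base as ℕ using (ℕ; zero; suc; _∸_)
  import Data.Nat.Properties as ℕ
  open import Data.Integer.Base using (+_; 1ℤ; _+_; -_)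
  import Data.Integer.Properties as ℤ
  open import Data.Integer.Tactic.RingSolver using (solve-∀)
  open import Data.Sum.Base using (inj₁; inj₂)
  open import Relation.Binary.PropositionalEquality
  open import Defs
  open PowerSeries
  open OverpartitionRecurrence

  ovpSeries : ℕ → Series
  ovpSeries k n = + ovp k n

  overlinepSeries : Series
  overlinepSeries n = + overlinep n

  qPoch : ℕ → Series
  qPoch zero    = 𝟙
  qPoch (suc k) = qPoch k ⊛ (𝟙 ⊖ X (suc k))

  negqPoch : ℕ → Series
  negqPoch zero    = 𝟙
  negqPoch (suc k) = negqPoch k ⊛ (𝟙 ⊕ X (suc k))

  ovpSeries-recurrence : ∀ k → ovpSeries (suc k) ⊖ shift (suc k) (ovpSeries (suc k))
                             ≈ ovpSeries k ⊕ shift (suc k) (ovpSeries k)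
  ovpSeries-recurrence k n with ℕ.<-≤-connex n (suc k)
  ... | inj₁ n<1+k
    rewrite shift-< (suc k) (ovpSeries (suc k)) n<1+k | shift-< (suc k) (ovpSeries k) n<1+k
          | ovp-suc-small k n n<1+k = refl
  ... | inj₂ k<n
    rewrite shift-≥ (suc k) (ovpSeries (suc k)) k<n | shift-≥ (suc k) (ovpSeries k) k<n
          | ovp-suc-large k n k<n
          | ℤ.pos-+ (ovp k n ℕ.+ ovp k (n ∸ suc k)) (ovp (suc k) (n ∸ suc k))
          | ℤ.pos-+ (ovp k n) (ovp k (n ∸ suc k)) =
    cancel (+ ovp k n) (+ ovp k (n ∸ suc k)) (+ ovp (suc k) (n ∸ suc k))
    where
    cancel : ∀ a b c → a + b + c + - c ≡ a + b
    cancel = solve-∀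

  ovpSeries-⊛-qPoch : ∀ k → ovpSeries k ⊛ qPoch k ≈ negqPoch k
  ovpSeries-⊛-qPoch zero = ≈-trans (⊛-comm (ovpSeries 0) 𝟙) (≈-trans (⊛-identityˡ (ovpSeries 0)) ovp₀)
    where
    ovp₀ : ovpSeries 0 ≈ 𝟙
    ovp₀ zero    = refl
    ovp₀ (suc n) = refl
  ovpSeries-⊛-qPoch (suc k) = begin
    F′ ⊛ (qPoch k ⊛ (𝟙 ⊖ x))
      ≈⟨ solve 3 (λ f d x → f :* (d :* (con 1ℤ :- x)) := (f :- x :* f) :* d) ≈-refl F′ (qPoch k) x ⟩
    (F′ ⊖ x ⊛ F′) ⊛ qPoch k
      ≈⟨ ⊛-congʳ (⊕-congˡ F′ (⊝-cong (X-⊛ (suc k) F′))) ⟩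
    (F′ ⊖ shift (suc k) F′) ⊛ qPoch k
      ≈⟨ ⊛-congʳ (ovpSeries-recurrence k) ⟩
    (F ⊕ shift (suc k) F) ⊛ qPoch k
      ≈⟨ ⊛-congʳ (⊕-congˡ F (≈-sym (X-⊛ (suc k) F))) ⟩
    (F ⊕ x ⊛ F) ⊛ qPoch k
      ≈⟨ solve 3 (λ f d x → (f :+ x :* f) :* d := (f :* d) :* (con 1ℤ :+ x)) ≈-refl F (qPoch k) x ⟩
    (F ⊛ qPoch k) ⊛ (𝟙 ⊕ x)
      ≈⟨ ⊛-congʳ (ovpSeries-⊛-qPoch k) ⟩
    negqPoch k ⊛ (𝟙 ⊕ x) ∎
    where
    open ≈-Reasoning
    F F′ x : Series
    F = ovpSeries k
    F′ = ovpSeries (suc k)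
    x = X (suc k)

module GaussianBinomials where

  open import Data.Nat.Base as ℕ using (ℕ; zero; suc; _+_; _<_; s≤s)
  import Data.Nat.Properties as ℕ
  open import Data.Nat.Tactic.RingSolver using (solve-∀)
  open import Data.Integer.Base using (0ℤ; 1ℤ)
  open import Relation.Binary.PropositionalEquality
  open PowerSeries
  open Truncation

  -- Powers of q²: the Gaussian binomial coefficients below are taken in base q².
  Q : ℕ → Series
  Q a = X (a + a)

  Q-+ : ∀ a b → Q a ⊛ Q b ≈ Q (a + b)
  Q-+ a b = X-+-≡ (a + a) (b + b) (regroup a b)
    where
    regroup : ∀ a b → a + a + (b + b) ≡ a + b + (a + b)
    regroup = solve-∀

  QPoch : ℕ → Series
  QPoch zero    = 𝟙
  QPoch (suc r) = QPoch r ⊛ (𝟙 ⊖ Q (suc r))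

  QPoch-constant : ∀ r → QPoch r 0 ≡ 1ℤ
  QPoch-constant zero = refl
  QPoch-constant (suc r) rewrite QPoch-constant r = refl

  binomQ : ℕ → ℕ → Series
  binomQ m       zero    = 𝟙
  binomQ zero    (suc k) = 𝟘
  binomQ (suc m) (suc k) = binomQ m k ⊕ Q (suc k) ⊛ binomQ m (suc k)

  binomQ-vanish : ∀ {m k} → m < k → binomQ m k ≈ 𝟘
  binomQ-vanish {zero}  {suc k} _         = ≈-refl
  binomQ-vanish {suc m} {suc k} (s≤s m<k) = begin
    binomQ m k ⊕ Q (suc k) ⊛ binomQ m (suc k)
      ≈⟨ ⊕-cong (binomQ-vanish m<k) (⊛-congˡ (binomQ-vanish (ℕ.m<n⇒m<1+n m<k))) ⟩
    𝟘 ⊕ Q (suc k) ⊛ 𝟘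
      ≈⟨ solve 1 (λ q → con 0ℤ :+ q :* con 0ℤ := con 0ℤ) ≈-refl (Q (suc k)) ⟩
    𝟘 ∎
    where open ≈-Reasoning

  binomQ-diag : ∀ k → binomQ k k ≈ 𝟙
  binomQ-diag zero    = ≈-refl
  binomQ-diag (suc k) = begin
    binomQ k k ⊕ Q (suc k) ⊛ binomQ k (suc k)
      ≈⟨ ⊕-cong (binomQ-diag k) (⊛-congˡ (binomQ-vanish (ℕ.n<1+n k))) ⟩
    𝟙 ⊕ Q (suc k) ⊛ 𝟘
      ≈⟨ solve 1 (λ q → con 1ℤ :+ q :* con 0ℤ := con 1ℤ) ≈-refl (Q (suc k)) ⟩
    𝟙 ∎
    where open ≈-Reasoning

  binomQ-product : ∀ k d → binomQ (k + d) k ⊛ QPoch k ⊛ QPoch d ≈ QPoch (k + d)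
  binomQ-product zero d = solve 1 (λ p → con 1ℤ :* con 1ℤ :* p := p) ≈-refl (QPoch d)
  binomQ-product (suc k) zero rewrite ℕ.+-identityʳ k = begin
    binomQ (suc k) (suc k) ⊛ QPoch (suc k) ⊛ 𝟙
      ≈⟨ ⊛-congʳ (⊛-congʳ (binomQ-diag (suc k))) ⟩
    𝟙 ⊛ QPoch (suc k) ⊛ 𝟙
      ≈⟨ solve 1 (λ p → con 1ℤ :* p :* con 1ℤ := p) ≈-refl (QPoch (suc k)) ⟩
    QPoch (suc k) ∎
    where open ≈-Reasoning
  binomQ-product (suc k) (suc d) = begin
    (B₀ ⊕ Q (suc k) ⊛ B₁) ⊛ (QPoch k ⊛ (𝟙 ⊖ Q (suc k))) ⊛ (QPoch d ⊛ (𝟙 ⊖ Q (suc d)))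
      ≈⟨ solve 6 (λ b₀ b₁ x y p p′ →
                    (b₀ :+ x :* b₁) :* (p :* (con 1ℤ :- x)) :* (p′ :* (con 1ℤ :- y))
                    := b₀ :* p :* (p′ :* (con 1ℤ :- y)) :* (con 1ℤ :- x)
                       :+ x :* (b₁ :* (p :* (con 1ℤ :- x)) :* p′) :* (con 1ℤ :- y))
                 ≈-refl B₀ B₁ (Q (suc k)) (Q (suc d)) (QPoch k) (QPoch d) ⟩
    B₀ ⊛ QPoch k ⊛ QPoch (suc d) ⊛ (𝟙 ⊖ Q (suc k)) ⊕ Q (suc k) ⊛ (B₁ ⊛ QPoch (suc k) ⊛ QPoch d) ⊛ (𝟙 ⊖ Q (suc d))
      ≈⟨ ⊕-cong (⊛-congʳ (binomQ-product k (suc d))) (⊛-congʳ (⊛-congˡ shifted)) ⟩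
    P ⊛ (𝟙 ⊖ Q (suc k)) ⊕ Q (suc k) ⊛ P ⊛ (𝟙 ⊖ Q (suc d))
      ≈⟨ solve 3 (λ p x y → p :* (con 1ℤ :- x) :+ x :* p :* (con 1ℤ :- y) := p :* (con 1ℤ :- x :* y))
                 ≈-refl P (Q (suc k)) (Q (suc d)) ⟩
    P ⊛ (𝟙 ⊖ Q (suc k) ⊛ Q (suc d))
      ≈⟨ ⊛-congˡ (⊕-congˡ 𝟙 (⊝-cong (Q-+ (suc k) (suc d)))) ⟩
    QPoch (suc k + suc d) ∎
    where
    open ≈-Reasoning
    B₀ B₁ P : Series
    B₀ = binomQ (k + suc d) k
    B₁ = binomQ (k + suc d) (suc k)
    P = QPoch (k + suc d)
    shifted : B₁ ⊛ QPoch (suc k) ⊛ QPoch d ≈ P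
    shifted = subst (λ m → binomQ m (suc k) ⊛ QPoch (suc k) ⊛ QPoch d ≈ QPoch m)
                    (sym (ℕ.+-suc k d)) (binomQ-product (suc k) d)

  binomQ-product-suc : ∀ k d → binomQ (k + d) (suc k) ⊛ QPoch (suc k) ⊛ QPoch d ≈ (𝟙 ⊖ Q d) ⊛ QPoch (k + d)
  binomQ-product-suc k zero = begin
    binomQ (k + 0) (suc k) ⊛ QPoch (suc k) ⊛ 𝟙
      ≈⟨ ⊛-congʳ (⊛-congʳ (binomQ-vanish (s≤s (ℕ.≤-reflexive (ℕ.+-identityʳ k))))) ⟩
    𝟘 ⊛ QPoch (suc k) ⊛ 𝟙
      ≈⟨ solve 2 (λ p p′ → con 0ℤ :* p :* con 1ℤ := (con 1ℤ :- con 1ℤ) :* p′) ≈-refl (QPoch (suc k)) (QPoch (k + 0)) ⟩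
    (𝟙 ⊖ 𝟙) ⊛ QPoch (k + 0) ∎
    where open ≈-Reasoning
  binomQ-product-suc k (suc d) rewrite ℕ.+-suc k d = begin
    B ⊛ QPoch (suc k) ⊛ (QPoch d ⊛ (𝟙 ⊖ Q (suc d)))
      ≈⟨ solve 4 (λ b p p′ y → b :* p :* (p′ :* (con 1ℤ :- y)) := (con 1ℤ :- y) :* (b :* p :* p′))
                 ≈-refl B (QPoch (suc k)) (QPoch d) (Q (suc d)) ⟩
    (𝟙 ⊖ Q (suc d)) ⊛ (B ⊛ QPoch (suc k) ⊛ QPoch d)
      ≈⟨ ⊛-congˡ (binomQ-product (suc k) d) ⟩
    (𝟙 ⊖ Q (suc d)) ⊛ QPoch (suc (k + d)) ∎
    where
    open ≈-Reasoning
    B : Series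
    B = binomQ (suc (k + d)) (suc k)

  binomQ-pascal-dual : ∀ k d → binomQ (suc (k + d)) (suc k) ≈ Q d ⊛ binomQ (k + d) k ⊕ binomQ (k + d) (suc k)
  binomQ-pascal-dual k d = ⊛-cancelʳ (QPoch (suc k) ⊛ QPoch d) unit (begin
    B ⊛ (QPoch (suc k) ⊛ QPoch d)
      ≈⟨ solve 3 (λ b p p′ → b :* (p :* p′) := b :* p :* p′) ≈-refl B (QPoch (suc k)) (QPoch d) ⟩
    B ⊛ QPoch (suc k) ⊛ QPoch d
      ≈⟨ binomQ-product (suc k) d ⟩
    P ⊛ (𝟙 ⊖ Q (suc (k + d)))
      ≈⟨ ⊛-congˡ (⊕-congˡ 𝟙 (⊝-cong (≈-sym (X-+-≡ (d + d) (suc k + suc k) (regroup k d))))) ⟩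
    P ⊛ (𝟙 ⊖ Q d ⊛ Q (suc k))
      ≈⟨ solve 3 (λ p y x → p :* (con 1ℤ :- y :* x) := y :* p :* (con 1ℤ :- x) :+ (con 1ℤ :- y) :* p)
                 ≈-refl P (Q d) (Q (suc k)) ⟩
    Q d ⊛ P ⊛ (𝟙 ⊖ Q (suc k)) ⊕ (𝟙 ⊖ Q d) ⊛ P
      ≈⟨ ⊕-cong (⊛-congʳ (⊛-congˡ (≈-sym (binomQ-product k d)))) (≈-sym (binomQ-product-suc k d)) ⟩
    Q d ⊛ (B₀ ⊛ QPoch k ⊛ QPoch d) ⊛ (𝟙 ⊖ Q (suc k)) ⊕ B₁ ⊛ QPoch (suc k) ⊛ QPoch d
      ≈⟨ solve 6 (λ y b₀ b₁ p p′ x → y :* (b₀ :* p :* p′) :* (con 1ℤ :- x) :+ b₁ :* (p :* (con 1ℤ :- x)) :* p′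
                                      := (y :* b₀ :+ b₁) :* ((p :* (con 1ℤ :- x)) :* p′))
                 ≈-refl (Q d) B₀ B₁ (QPoch k) (QPoch d) (Q (suc k)) ⟩
    (Q d ⊛ B₀ ⊕ B₁) ⊛ (QPoch (suc k) ⊛ QPoch d) ∎)
    where
    open ≈-Reasoning
    B B₀ B₁ P : Series
    B = binomQ (suc (k + d)) (suc k)
    B₀ = binomQ (k + d) k
    B₁ = binomQ (k + d) (suc k)
    P = QPoch (k + d)
    regroup : ∀ k d → d + d + (suc k + suc k) ≡ suc (k + d) + suc (k + d)
    regroup = solve-∀
    unit : (QPoch (suc k) ⊛ QPoch d) 0 ≡ 1ℤ
    unit rewrite QPoch-constant (suc k) | QPoch-constant d = refl

  binomQ-two-step₁ : ∀ m → binomQ (suc (suc m)) 1 ≈ 𝟙 ⊕ Q (suc m) ⊕ Q 1 ⊛ binomQ m 1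
  binomQ-two-step₁ m = begin
    𝟙 ⊕ Q 1 ⊛ binomQ (suc m) 1
      ≈⟨ ⊕-congˡ 𝟙 (⊛-congˡ (binomQ-pascal-dual 0 m)) ⟩
    𝟙 ⊕ Q 1 ⊛ (Q m ⊛ 𝟙 ⊕ binomQ m 1)
      ≈⟨ solve 3 (λ x y b → con 1ℤ :+ x :* (y :* con 1ℤ :+ b) := con 1ℤ :+ x :* y :+ x :* b)
                 ≈-refl (Q 1) (Q m) (binomQ m 1) ⟩
    𝟙 ⊕ Q 1 ⊛ Q m ⊕ Q 1 ⊛ binomQ m 1
      ≈⟨ ⊕-congʳ (Q 1 ⊛ binomQ m 1) (⊕-congˡ 𝟙 (Q-+ 1 m)) ⟩
    𝟙 ⊕ Q (suc m) ⊕ Q 1 ⊛ binomQ m 1 ∎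
    where open ≈-Reasoning

  binomQ-two-step : ∀ k d →
    binomQ (suc (suc (k + d))) (suc (suc k)) ≈
      (𝟙 ⊕ Q (suc (k + d))) ⊛ binomQ (k + d) (suc k) ⊕ Q d ⊛ binomQ (k + d) k
      ⊕ Q (suc (suc k)) ⊛ binomQ (k + d) (suc (suc k))
  binomQ-two-step k zero = begin
    binomQ (suc (k + 0)) (suc k) ⊕ Q (suc (suc k)) ⊛ binomQ (suc (k + 0)) (suc (suc k))
      ≈⟨ ⊕-cong (binomQ-pascal-dual k 0) (⊛-congˡ (binomQ-vanish (s≤s k+0<1+k))) ⟩
    Q 0 ⊛ B₀ ⊕ B₁ ⊕ Q (suc (suc k)) ⊛ 𝟘
      ≈⟨ ⊕-congʳ (Q (suc (suc k)) ⊛ 𝟘) (⊕-congˡ (Q 0 ⊛ B₀) (binomQ-vanish k+0<1+k)) ⟩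
    Q 0 ⊛ B₀ ⊕ 𝟘 ⊕ Q (suc (suc k)) ⊛ 𝟘
      ≈⟨ solve 4 (λ y b₀ x z → y :* b₀ :+ con 0ℤ :+ z :* con 0ℤ
                              := (con 1ℤ :+ x) :* con 0ℤ :+ y :* b₀ :+ z :* con 0ℤ)
                 ≈-refl (Q 0) B₀ (Q (suc (k + 0))) (Q (suc (suc k))) ⟩
    (𝟙 ⊕ Q (suc (k + 0))) ⊛ 𝟘 ⊕ Q 0 ⊛ B₀ ⊕ Q (suc (suc k)) ⊛ 𝟘
      ≈⟨ ⊕-cong (⊕-congʳ (Q 0 ⊛ B₀) (⊛-congˡ (≈-sym (binomQ-vanish k+0<1+k))))
                (⊛-congˡ (≈-sym (binomQ-vanish (ℕ.m<n⇒m<1+n k+0<1+k)))) ⟩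
    (𝟙 ⊕ Q (suc (k + 0))) ⊛ B₁ ⊕ Q 0 ⊛ B₀ ⊕ Q (suc (suc k)) ⊛ binomQ (k + 0) (suc (suc k)) ∎
    where
    open ≈-Reasoning
    B₀ B₁ : Series
    B₀ = binomQ (k + 0) k
    B₁ = binomQ (k + 0) (suc k)
    k+0<1+k : k + 0 < suc k
    k+0<1+k = s≤s (ℕ.≤-reflexive (ℕ.+-identityʳ k))
  binomQ-two-step k (suc d) = begin
    binomQ (suc (k + suc d)) (suc k) ⊕ Q (suc (suc k)) ⊛ binomQ (suc (k + suc d)) (suc (suc k))
      ≈⟨ ⊕-cong (binomQ-pascal-dual k (suc d)) (⊛-congˡ next) ⟩
    Q (suc d) ⊛ B₀ ⊕ B₁ ⊕ Q (suc (suc k)) ⊛ (Q d ⊛ B₁ ⊕ B₂)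
      ≈⟨ solve 6 (λ y b₀ b₁ z x b₂ → y :* b₀ :+ b₁ :+ z :* (x :* b₁ :+ b₂)
                                    := (con 1ℤ :+ z :* x) :* b₁ :+ y :* b₀ :+ z :* b₂)
                 ≈-refl (Q (suc d)) B₀ B₁ (Q (suc (suc k))) (Q d) B₂ ⟩
    (𝟙 ⊕ Q (suc (suc k)) ⊛ Q d) ⊛ B₁ ⊕ Q (suc d) ⊛ B₀ ⊕ Q (suc (suc k)) ⊛ B₂
      ≈⟨ ⊕-congʳ (Q (suc (suc k)) ⊛ B₂) (⊕-congʳ (Q (suc d) ⊛ B₀) (⊛-congʳ (⊕-congˡ 𝟙 exponent))) ⟩
    (𝟙 ⊕ Q (suc (k + suc d))) ⊛ B₁ ⊕ Q (suc d) ⊛ B₀ ⊕ Q (suc (suc k)) ⊛ B₂ ∎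
    where
    open ≈-Reasoning
    B₀ B₁ B₂ : Series
    B₀ = binomQ (k + suc d) k
    B₁ = binomQ (k + suc d) (suc k)
    B₂ = binomQ (k + suc d) (suc (suc k))
    next : binomQ (suc (k + suc d)) (suc (suc k)) ≈ Q d ⊛ B₁ ⊕ B₂
    next = subst (λ m → binomQ (suc m) (suc (suc k)) ≈ Q d ⊛ binomQ m (suc k) ⊕ binomQ m (suc (suc k)))
                 (sym (ℕ.+-suc k d)) (binomQ-pascal-dual (suc k) d)
    exponent : Q (suc (suc k)) ⊛ Q d ≈ Q (suc (k + suc d))
    exponent = ≈-trans (Q-+ (suc (suc k)) d) (λ n → cong (λ a → Q a n) (sym (ℕ.+-suc (suc k) d)))

module FiniteJacobiTripleProduct where

  open import Data.Nat.Base as ℕ using (ℕ; zero; suc; _∸_; _<_; s≤s)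
  import Data.Nat.Properties as ℕ
  open import Data.Integer.Base using (+_; 0ℤ; 1ℤ; _+_; _*_; -_; _-_)
  import Data.Integer.Properties as ℤ
  open import Data.Integer.Tactic.RingSolver using (solve-∀)
  open import Data.Sum.Base using (inj₁; inj₂)
  open import Relation.Nullary.Decidable.Core using (yes; no)
  open import Relation.Binary.PropositionalEquality
  open PowerSeries
  open AlternatingSums
  open GaussianBinomials

  -- (k - n)², as one of the two truncated differences is 0.
  sqDist : ℕ → ℕ → ℕ
  sqDist n k = (k ∸ n) ℕ.* (k ∸ n) ℕ.+ (n ∸ k) ℕ.* (n ∸ k)

  sqDist-ℤ : ∀ n k → + sqDist n k ≡ (+ k - + n) * (+ k - + n)
  sqDist-ℤ n k with ℕ.≤-total n k
  ... | inj₁ n≤k rewrite ℕ.m≤n⇒m∸n≡0 n≤k | ℤ.m-n≡m⊖n k n | ℤ.⊖-≥ n≤k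
                       | ℕ.+-identityʳ ((k ∸ n) ℕ.* (k ∸ n)) = ℤ.pos-* (k ∸ n) (k ∸ n)
  ... | inj₂ k≤n rewrite ℕ.m≤n⇒m∸n≡0 k≤n | ℤ.m-n≡m⊖n k n | ℤ.⊖-≤ k≤n =
    trans (ℤ.pos-* (n ∸ k) (n ∸ k)) (square-neg (+ (n ∸ k)))
    where
    square-neg : ∀ a → a * a ≡ (- a) * (- a)
    square-neg = solve-∀

  -- Exponent bookkeeping is done in ℤ, where (k - n)² is a polynomial.
  X-exchange : ∀ a b c d {A B C D} → + a ≡ A → + b ≡ B → + c ≡ C → + d ≡ D → A + B ≡ C + D →
               X a ⊛ X b ≈ X c ⊛ X d
  X-exchange a b c d refl refl refl refl eq = begin
    X a ⊛ X b          ≈⟨ X-+ a b ⟩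
    X (a ℕ.+ b)        ≡⟨ cong X (ℤ.+-injective (trans (ℤ.pos-+ a b) (trans eq (sym (ℤ.pos-+ c d))))) ⟩
    X (c ℕ.+ d)        ≈⟨ X-+ c d ⟨
    X c ⊛ X d          ∎
    where open ≈-Reasoning

  term : ℕ → ℕ → Series
  term n k = X (sqDist n k) ⊛ binomQ (n ℕ.+ n) k

  Xodd : ℕ → Series
  Xodd n = X (suc (n ℕ.+ n))

  binomQ-index : ∀ n k → binomQ (suc n ℕ.+ suc n) k ≡ binomQ (suc (suc (n ℕ.+ n))) k
  binomQ-index n k = cong (λ m → binomQ (suc m) k) (ℕ.+-suc n n)

  term-suc-0 : ∀ n → term (suc n) 0 ≈ Xodd n ⊛ term n 0
  term-suc-0 n = begin
    X (sqDist (suc n) 0) ⊛ X 0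
      ≈⟨ X-exchange (suc (n ℕ.+ n)) (sqDist n 0) (sqDist (suc n) 0) 0 refl (sqDist-ℤ n 0)
           (sqDist-ℤ (suc n) 0) refl
           (exponents (+ n)) ⟨
    Xodd n ⊛ X (sqDist n 0)
      ≈⟨ solve 2 (λ x y → x :* y := x :* (y :* con 1ℤ)) ≈-refl (Xodd n) (X (sqDist n 0)) ⟩
    Xodd n ⊛ term n 0 ∎
    where
    open ≈-Reasoning
    exponents : ∀ N → 1ℤ + (N + N) + (0ℤ - N) * (0ℤ - N) ≡ (0ℤ - (1ℤ + N)) * (0ℤ - (1ℤ + N)) + 0ℤ
    exponents = solve-∀

  term-suc-1 : ∀ n → term (suc n) 1 ≈ (𝟙 ⊕ Q (suc (n ℕ.+ n))) ⊛ term n 0 ⊕ Xodd n ⊛ term n 1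
  term-suc-1 n = begin
    X W ⊛ binomQ (suc n ℕ.+ suc n) 1
      ≡⟨ cong (X W ⊛_) (binomQ-index n 1) ⟩
    X W ⊛ binomQ (suc (suc (n ℕ.+ n))) 1
      ≈⟨ ⊛-congˡ (binomQ-two-step₁ (n ℕ.+ n)) ⟩
    X W ⊛ (𝟙 ⊕ y ⊕ Q 1 ⊛ B)
      ≈⟨ solve 4 (λ w y z b → w :* (con 1ℤ :+ y :+ z :* b) := (con 1ℤ :+ y) :* (w :* con 1ℤ) :+ (w :* z) :* b)
                 ≈-refl (X W) y (Q 1) B ⟩
    (𝟙 ⊕ y) ⊛ term n 0 ⊕ (X W ⊛ Q 1) ⊛ B
      ≈⟨ ⊕-congˡ ((𝟙 ⊕ y) ⊛ term n 0) (⊛-congʳ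
           (X-exchange W 2 (suc (n ℕ.+ n)) (sqDist n 1) (sqDist-ℤ (suc n) 1) refl refl (sqDist-ℤ n 1)
                       (exponents (+ n)))) ⟩
    (𝟙 ⊕ y) ⊛ term n 0 ⊕ (Xodd n ⊛ X (sqDist n 1)) ⊛ B
      ≈⟨ ⊕-congˡ ((𝟙 ⊕ y) ⊛ term n 0) (⊛-assoc (Xodd n) (X (sqDist n 1)) B) ⟩
    (𝟙 ⊕ y) ⊛ term n 0 ⊕ Xodd n ⊛ term n 1 ∎
    where
    open ≈-Reasoning
    W : ℕ
    W = sqDist (suc n) 1
    y B : Series
    y = Q (suc (n ℕ.+ n))
    B = binomQ (n ℕ.+ n) 1
    exponents : ∀ N → (+ 1 - (1ℤ + N)) * (+ 1 - (1ℤ + N)) + + 2 ≡ 1ℤ + (N + N) + (+ 1 - N) * (+ 1 - N)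
    exponents = solve-∀

  term-vanish : ∀ n k → n ℕ.+ n < k → term n k ≈ 𝟘
  term-vanish n k 2n<k = ≈-trans (⊛-congˡ (binomQ-vanish 2n<k))
                                 (solve 1 (λ x → x :* con 0ℤ := con 0ℤ) ≈-refl (X (sqDist n k)))

  term-suc-suc : ∀ n k → term (suc n) (suc (suc k)) ≈
                         (𝟙 ⊕ Q (suc (n ℕ.+ n))) ⊛ term n (suc k) ⊕ Xodd n ⊛ (term n k ⊕ term n (suc (suc k)))
  term-suc-suc n k with k ℕ.≤? n ℕ.+ n
  ... | yes k≤2n = begin
    X W ⊛ binomQ (suc n ℕ.+ suc n) (suc (suc k))
      ≡⟨ cong (X W ⊛_) (binomQ-index n (suc (suc k))) ⟩
    X W ⊛ binomQ (suc (suc (n ℕ.+ n))) (suc (suc k))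
      ≈⟨ ⊛-congˡ double ⟩
    X W ⊛ ((𝟙 ⊕ y) ⊛ B₁ ⊕ Q d ⊛ B₀ ⊕ Q (suc (suc k)) ⊛ B₂)
      ≈⟨ solve 7 (λ w y b₁ z b₀ z′ b₂ → w :* ((con 1ℤ :+ y) :* b₁ :+ z :* b₀ :+ z′ :* b₂)
                                        := (con 1ℤ :+ y) :* (w :* b₁) :+ (w :* z) :* b₀ :+ (w :* z′) :* b₂)
                 ≈-refl (X W) y B₁ (Q d) B₀ (Q (suc (suc k))) B₂ ⟩
    (𝟙 ⊕ y) ⊛ term n (suc k) ⊕ (X W ⊛ Q d) ⊛ B₀ ⊕ (X W ⊛ Q (suc (suc k))) ⊛ B₂
      ≈⟨ ⊕-cong (⊕-congˡ ((𝟙 ⊕ y) ⊛ term n (suc k)) (⊛-congʳ below)) (⊛-congʳ above) ⟩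
    (𝟙 ⊕ y) ⊛ term n (suc k) ⊕ (Xodd n ⊛ X (sqDist n k)) ⊛ B₀ ⊕ (Xodd n ⊛ X (sqDist n (suc (suc k)))) ⊛ B₂
      ≈⟨ solve 6 (λ a x u b₀ v b₂ → a :+ (x :* u) :* b₀ :+ (x :* v) :* b₂ := a :+ x :* (u :* b₀ :+ v :* b₂))
                 ≈-refl ((𝟙 ⊕ y) ⊛ term n (suc k)) (Xodd n) (X (sqDist n k)) B₀ (X (sqDist n (suc (suc k)))) B₂ ⟩
    (𝟙 ⊕ y) ⊛ term n (suc k) ⊕ Xodd n ⊛ (term n k ⊕ term n (suc (suc k))) ∎
    where
    open ≈-Reasoning
    W : ℕ
    W = sqDist (suc n) (suc (suc k))
    y : Series
    y = Q (suc (n ℕ.+ n))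
    d : ℕ
    d = n ℕ.+ n ∸ k
    B₀ B₁ B₂ : Series
    B₀ = binomQ (n ℕ.+ n) k
    B₁ = binomQ (n ℕ.+ n) (suc k)
    B₂ = binomQ (n ℕ.+ n) (suc (suc k))
    double : binomQ (suc (suc (n ℕ.+ n))) (suc (suc k)) ≈ (𝟙 ⊕ y) ⊛ B₁ ⊕ Q d ⊛ B₀ ⊕ Q (suc (suc k)) ⊛ B₂
    double = subst (λ m → binomQ (suc (suc m)) (suc (suc k)) ≈
                          (𝟙 ⊕ Q (suc m)) ⊛ binomQ m (suc k) ⊕ Q d ⊛ binomQ m k ⊕ Q (suc (suc k)) ⊛ binomQ m (suc (suc k)))
                   (ℕ.m+[n∸m]≡n k≤2n) (binomQ-two-step k d)
    d-ℤ : + d ≡ (+ n + + n) - + k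
    d-ℤ = trans (sym (ℤ.⊖-≥ k≤2n)) (trans (sym (ℤ.m-n≡m⊖n (n ℕ.+ n) k)) (cong (_- + k) (ℤ.pos-+ n n)))
    below-exponents : ∀ K N → (1ℤ + K - N) * (1ℤ + K - N) + ((N + N - K) + (N + N - K))
                              ≡ 1ℤ + (N + N) + (K - N) * (K - N)
    below-exponents = solve-∀
    below : X W ⊛ Q d ≈ Xodd n ⊛ X (sqDist n k)
    below = X-exchange W (d ℕ.+ d) (suc (n ℕ.+ n)) (sqDist n k) (sqDist-ℤ n (suc k))
              (trans (ℤ.pos-+ d d) (cong₂ _+_ d-ℤ d-ℤ)) refl (sqDist-ℤ n k) (below-exponents (+ k) (+ n))
    above-exponents : ∀ K N → (1ℤ + K - N) * (1ℤ + K - N) + ((+ 2 + K) + (+ 2 + K))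
                              ≡ 1ℤ + (N + N) + (+ 2 + K - N) * (+ 2 + K - N)
    above-exponents = solve-∀
    above : X W ⊛ Q (suc (suc k)) ≈ Xodd n ⊛ X (sqDist n (suc (suc k)))
    above = X-exchange W (suc (suc k) ℕ.+ suc (suc k)) (suc (n ℕ.+ n)) (sqDist n (suc (suc k)))
              (sqDist-ℤ n (suc k)) (ℤ.pos-+ (suc (suc k)) (suc (suc k))) refl (sqDist-ℤ n (suc (suc k)))
              (above-exponents (+ k) (+ n))
  ... | no k≰2n = begin
    term (suc n) (suc (suc k))
      ≈⟨ term-vanish (suc n) (suc (suc k)) (subst (_< suc (suc k)) (sym (ℕ.+-suc (suc n) n)) (s≤s (s≤s 2n<k))) ⟩
    𝟘
      ≈⟨ solve 2 (λ y x → con 0ℤ := (con 1ℤ :+ y) :* con 0ℤ :+ x :* (con 0ℤ :+ con 0ℤ)) ≈-refl (Q (suc (n ℕ.+ n))) (Xodd n) ⟩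
    (𝟙 ⊕ Q (suc (n ℕ.+ n))) ⊛ 𝟘 ⊕ Xodd n ⊛ (𝟘 ⊕ 𝟘)
      ≈⟨ ⊕-cong (⊛-congˡ (≈-sym (term-vanish n (suc k) (ℕ.m<n⇒m<1+n 2n<k))))
                (⊛-congˡ (⊕-cong (≈-sym (term-vanish n k 2n<k))
                                 (≈-sym (term-vanish n (suc (suc k)) (ℕ.m<n⇒m<1+n (ℕ.m<n⇒m<1+n 2n<k)))))) ⟩
    (𝟙 ⊕ Q (suc (n ℕ.+ n))) ⊛ term n (suc k) ⊕ Xodd n ⊛ (term n k ⊕ term n (suc (suc k))) ∎
    where
    open ≈-Reasoning
    2n<k : n ℕ.+ n < k
    2n<k = ℕ.≰⇒> k≰2n

  jacobiSum : ℕ → Series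
  jacobiSum n = altSum (term n) (suc (n ℕ.+ n))

  altSum-term-suc : ∀ n L → altSum (λ k → term (suc n) (suc (suc k))) L ≈
    (𝟙 ⊕ Q (suc (n ℕ.+ n))) ⊛ altSum (λ k → term n (suc k)) L
    ⊕ Xodd n ⊛ (altSum (term n) L ⊕ altSum (λ k → term n (suc (suc k))) L)
  altSum-term-suc n L = begin
    altSum (λ k → term (suc n) (suc (suc k))) L
      ≈⟨ altSum-cong L (term-suc-suc n) ⟩
    altSum (λ k → y′ ⊛ term n (suc k) ⊕ x ⊛ (term n k ⊕ term n (suc (suc k)))) L
      ≈⟨ altSum-⊕ (λ k → y′ ⊛ term n (suc k)) (λ k → x ⊛ (term n k ⊕ term n (suc (suc k)))) L ⟩
    altSum (λ k → y′ ⊛ term n (suc k)) L ⊕ altSum (λ k → x ⊛ (term n k ⊕ term n (suc (suc k)))) L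
      ≈⟨ ⊕-cong (altSum-⊛ y′ (λ k → term n (suc k)) L) (altSum-⊛ x (λ k → term n k ⊕ term n (suc (suc k))) L) ⟩
    y′ ⊛ altSum (λ k → term n (suc k)) L ⊕ x ⊛ altSum (λ k → term n k ⊕ term n (suc (suc k))) L
      ≈⟨ ⊕-congˡ (y′ ⊛ altSum (λ k → term n (suc k)) L) (⊛-congˡ (altSum-⊕ (term n) (λ k → term n (suc (suc k))) L)) ⟩
    y′ ⊛ altSum (λ k → term n (suc k)) L ⊕ x ⊛ (altSum (term n) L ⊕ altSum (λ k → term n (suc (suc k))) L) ∎
    where
    open ≈-Reasoning
    x y′ : Series
    x = Xodd n
    y′ = 𝟙 ⊕ Q (suc (n ℕ.+ n))

  jacobiSum-suc : ∀ n → jacobiSum (suc n) ≈ ⊝ ((𝟙 ⊖ Xodd n) ⊛ (𝟙 ⊖ Xodd n)) ⊛ jacobiSum n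
  jacobiSum-suc n = begin
    term (suc n) 0 ⊖ (term (suc n) 1 ⊖ altSum (λ k → term (suc n) (suc (suc k))) (n ℕ.+ suc n))
      ≡⟨ cong (λ m → term (suc n) 0 ⊖ (term (suc n) 1 ⊖ altSum (λ k → term (suc n) (suc (suc k))) m)) (ℕ.+-suc n n) ⟩
    term (suc n) 0 ⊖ (term (suc n) 1 ⊖ altSum (λ k → term (suc n) (suc (suc k))) L)
      ≈⟨ ⊕-cong (term-suc-0 n) (⊝-cong (⊕-cong (term-suc-1 n) (⊝-cong (altSum-term-suc n L)))) ⟩
    x ⊛ e₀ ⊖ ((𝟙 ⊕ y) ⊛ e₀ ⊕ x ⊛ e₁ ⊖ ((𝟙 ⊕ y) ⊛ T₁ ⊕ x ⊛ (S ⊕ T₂)))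
      ≈⟨ ⊕-congˡ (x ⊛ e₀) (⊝-cong (⊕-cong (⊕-congʳ (x ⊛ e₁) (⊛-congʳ (⊕-congˡ 𝟙 y≈x²)))
                                          (⊝-cong (⊕-cong (⊛-cong (⊕-congˡ 𝟙 y≈x²) T₁≈)
                                                          (⊛-congˡ (⊕-congˡ S T₂≈)))))) ⟩
    x ⊛ e₀ ⊖ ((𝟙 ⊕ x ⊛ x) ⊛ e₀ ⊕ x ⊛ e₁ ⊖ ((𝟙 ⊕ x ⊛ x) ⊛ (e₀ ⊖ S) ⊕ x ⊛ (S ⊕ (e₁ ⊖ (e₀ ⊖ S)))))
      ≈⟨ solve 4 (λ x e₀ e₁ s →
                    x :* e₀ :- ((con 1ℤ :+ x :* x) :* e₀ :+ x :* e₁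
                                :- ((con 1ℤ :+ x :* x) :* (e₀ :- s) :+ x :* (s :+ (e₁ :- (e₀ :- s)))))
                    := :- ((con 1ℤ :- x) :* (con 1ℤ :- x)) :* s)
                 ≈-refl x e₀ e₁ S ⟩
    ⊝ ((𝟙 ⊖ x) ⊛ (𝟙 ⊖ x)) ⊛ S ∎
    where
    open ≈-Reasoning
    L : ℕ
    L = suc (n ℕ.+ n)
    x y S e₀ e₁ T₁ T₂ : Series
    x = Xodd n
    y = Q (suc (n ℕ.+ n))
    S = jacobiSum n
    e₀ = term n 0
    e₁ = term n 1
    T₁ = altSum (λ k → term n (suc k)) L
    T₂ = altSum (λ k → term n (suc (suc k))) L
    y≈x² : y ≈ x ⊛ x
    y≈x² = ≈-sym (X-+ (suc (n ℕ.+ n)) (suc (n ℕ.+ n)))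
    T₁≈ : T₁ ≈ e₀ ⊖ S
    T₁≈ = altSum-tail (term n) L (term-vanish n L (ℕ.n<1+n (n ℕ.+ n)))
    T₂≈ : T₂ ≈ e₁ ⊖ (e₀ ⊖ S)
    T₂≈ = ≈-trans (altSum-tail (λ k → term n (suc k)) L (term-vanish n (suc L) (ℕ.m<n⇒m<1+n (ℕ.n<1+n (n ℕ.+ n)))))
                  (⊕-congˡ e₁ (⊝-cong T₁≈))

  oddPoch : ℕ → Series
  oddPoch zero    = 𝟙
  oddPoch (suc n) = oddPoch n ⊛ (𝟙 ⊖ Xodd n)

  jacobiSum-closed : ∀ n → jacobiSum n ≈ sign n ⊛ (oddPoch n ⊛ oddPoch n)
  jacobiSum-closed zero    = solve 0 (con 1ℤ :* con 1ℤ :- con 0ℤ := con 1ℤ :* (con 1ℤ :* con 1ℤ)) ≈-refl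
  jacobiSum-closed (suc n) = begin
    jacobiSum (suc n)
      ≈⟨ jacobiSum-suc n ⟩
    ⊝ ((𝟙 ⊖ Xodd n) ⊛ (𝟙 ⊖ Xodd n)) ⊛ jacobiSum n
      ≈⟨ ⊛-congˡ (jacobiSum-closed n) ⟩
    ⊝ ((𝟙 ⊖ Xodd n) ⊛ (𝟙 ⊖ Xodd n)) ⊛ (sign n ⊛ (oddPoch n ⊛ oddPoch n))
      ≈⟨ solve 3 (λ x s o → :- ((con 1ℤ :- x) :* (con 1ℤ :- x)) :* (s :* (o :* o))
                            := (:- s) :* ((o :* (con 1ℤ :- x)) :* (o :* (con 1ℤ :- x))))
                 ≈-refl (Xodd n) (sign n) (oddPoch n) ⟩
    sign (suc n) ⊛ (oddPoch (suc n) ⊛ oddPoch (suc n)) ∎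
    where open ≈-Reasoning

module TruncatedTheta where

  open import Data.Nat.Base as ℕ using (ℕ; zero; suc; _∸_; _≤_; z≤n; s≤s)
  import Data.Nat.Properties as ℕ
  open import Data.Nat.Tactic.RingSolver using (solve-∀)
  open import Data.Integer.Base using (+_; 0ℤ; 1ℤ; _+_; _*_; _-_)
  import Data.Integer.Properties as ℤ
  open import Data.Integer.Tactic.RingSolver using () renaming (solve-∀ to ℤ-solve-∀)
  open import Data.Sum.Base using (inj₁; inj₂)
  open import Relation.Binary.PropositionalEquality
  open PowerSeries
  open AlternatingSums
  open Truncation
  open GaussianBinomials
  open FiniteJacobiTripleProduct

  QPoch-stable : ∀ {a r} → a ≤ r → QPoch r ≈[ suc a ℕ.+ suc a ] QPoch a
  QPoch-stable {a} {r} a≤r = subst (λ r → QPoch r ≈[ M ] QPoch a) (ℕ.m∸n+n≡m a≤r) (stable (r ∸ a))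
    where
    M : ℕ
    M = suc a ℕ.+ suc a
    open ≈[]-Reasoning M
    stable : ∀ t → QPoch (t ℕ.+ a) ≈[ M ] QPoch a
    stable zero    = ≈[]-refl M
    stable (suc t) = begin
      QPoch (t ℕ.+ a) ⊛ (𝟙 ⊖ Q (suc (t ℕ.+ a)))
        ≈⟨ ⊛-cong[] M (≈[]-refl M) (⊕-cong[] M (≈[]-refl {𝟙} M) (⊝-cong[] M (≈[]-weaken M≤ (shift≈[]𝟘 _ 𝟙)))) ⟩
      QPoch (t ℕ.+ a) ⊛ (𝟙 ⊖ 𝟘)
        ≈⟨ ≈⇒≈[] M (solve 1 (λ p → p :* (con 1ℤ :- con 0ℤ) := p) ≈-refl (QPoch (t ℕ.+ a))) ⟩
      QPoch (t ℕ.+ a)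
        ≈⟨ stable t ⟩
      QPoch a ∎
      where
      M≤ : M ≤ suc (t ℕ.+ a) ℕ.+ suc (t ℕ.+ a)
      M≤ = ℕ.+-mono-≤ (s≤s (ℕ.m≤n+m a t)) (s≤s (ℕ.m≤n+m a t))

  QPoch-⊛-binomQ : ∀ k d n a → a ≤ k → a ≤ d → a ≤ n → QPoch n ⊛ binomQ (k ℕ.+ d) k ≈[ suc a ℕ.+ suc a ] 𝟙
  QPoch-⊛-binomQ k d n a a≤k a≤d a≤n = ⊛-cancelʳ[] (QPoch a ⊛ QPoch a) M unit (begin
    (QPoch n ⊛ B) ⊛ (QPoch a ⊛ QPoch a)
      ≈⟨ ≈⇒≈[] M (solve 3 (λ p b r → (p :* b) :* (r :* r) := p :* (b :* r :* r)) ≈-refl (QPoch n) B (QPoch a)) ⟩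
    QPoch n ⊛ (B ⊛ QPoch a ⊛ QPoch a)
      ≈⟨ ⊛-cong[] M (≈[]-refl M) (⊛-cong[] M (⊛-cong[] M (≈[]-refl M) (≈[]-sym M (QPoch-stable a≤k)))
                                               (≈[]-sym M (QPoch-stable a≤d))) ⟩
    QPoch n ⊛ (B ⊛ QPoch k ⊛ QPoch d)
      ≈⟨ ≈⇒≈[] M (⊛-congˡ (binomQ-product k d)) ⟩
    QPoch n ⊛ QPoch (k ℕ.+ d)
      ≈⟨ ⊛-cong[] M (QPoch-stable a≤n) (QPoch-stable (ℕ.≤-trans a≤k (ℕ.m≤m+n k d))) ⟩
    QPoch a ⊛ QPoch a
      ≈⟨ ≈⇒≈[] M (≈-sym (⊛-identityˡ (QPoch a ⊛ QPoch a))) ⟩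
    𝟙 ⊛ (QPoch a ⊛ QPoch a) ∎)
    where
    M : ℕ
    M = suc a ℕ.+ suc a
    B : Series
    B = binomQ (k ℕ.+ d) k
    open ≈[]-Reasoning M
    unit : (QPoch a ⊛ QPoch a) 0 ≡ 1ℤ
    unit rewrite QPoch-constant a = refl

  QPoch-⊛-term-general : ∀ n k d a → k ℕ.+ d ≡ n ℕ.+ n → a ≤ k → a ≤ d → a ≤ n →
                         suc (n ℕ.+ n) ≤ sqDist n k ℕ.+ (suc a ℕ.+ suc a) →
                         QPoch n ⊛ term n k ≈[ suc (n ℕ.+ n) ] X (sqDist n k)
  QPoch-⊛-term-general n k d a k+d≡2n a≤k a≤d a≤n bound = ≈[]-weaken bound (begin
    QPoch n ⊛ (X W ⊛ binomQ (n ℕ.+ n) k)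
      ≈⟨ ≈⇒≈[] M′ (solve 3 (λ p x b → p :* (x :* b) := x :* (p :* b)) ≈-refl (QPoch n) (X W) (binomQ (n ℕ.+ n) k)) ⟩
    X W ⊛ (QPoch n ⊛ binomQ (n ℕ.+ n) k)
      ≈⟨ ≈⇒≈[] M′ (X-⊛ W (QPoch n ⊛ binomQ (n ℕ.+ n) k)) ⟩
    shift W (QPoch n ⊛ binomQ (n ℕ.+ n) k)
      ≈⟨ shift-cong[] W M (subst (λ m → QPoch n ⊛ binomQ m k ≈[ M ] 𝟙) k+d≡2n (QPoch-⊛-binomQ k d n a a≤k a≤d a≤n)) ⟩
    X W ∎)
    where
    W M M′ : ℕ
    W = sqDist n k
    M = suc a ℕ.+ suc a
    M′ = W ℕ.+ M
    open ≈[]-Reasoning M′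

  -- The truncation orders fit because 2t ≤ t² + 1, i.e. (t - 1)² ≥ 0.
  order-bound : ∀ t a → suc ((t ℕ.+ a) ℕ.+ (t ℕ.+ a)) ≤ t ℕ.* t ℕ.+ (suc a ℕ.+ suc a)
  order-bound t a = subst₂ _≤_ (regroupˡ t a) (regroupʳ t a) (ℕ.+-monoˡ-≤ (suc (a ℕ.+ a)) (double≤square+1 t))
    where
    double≤square+1 : ∀ t → t ℕ.+ t ≤ t ℕ.* t ℕ.+ 1
    double≤square+1 zero    = z≤n
    double≤square+1 (suc u) = subst (suc u ℕ.+ suc u ≤_) (expand u) (ℕ.m≤n+m (suc u ℕ.+ suc u) (u ℕ.* u))
      where
      expand : ∀ u → u ℕ.* u ℕ.+ (suc u ℕ.+ suc u) ≡ suc u ℕ.* suc u ℕ.+ 1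
      expand = solve-∀
    regroupˡ : ∀ t a → t ℕ.+ t ℕ.+ suc (a ℕ.+ a) ≡ suc ((t ℕ.+ a) ℕ.+ (t ℕ.+ a))
    regroupˡ = solve-∀
    regroupʳ : ∀ t a → t ℕ.* t ℕ.+ 1 ℕ.+ suc (a ℕ.+ a) ≡ t ℕ.* t ℕ.+ (suc a ℕ.+ suc a)
    regroupʳ = solve-∀

  QPoch-⊛-term-below : ∀ k t → QPoch (k ℕ.+ t) ⊛ term (k ℕ.+ t) k ≈[ suc ((k ℕ.+ t) ℕ.+ (k ℕ.+ t)) ] X (sqDist (k ℕ.+ t) k)
  QPoch-⊛-term-below k t =
    QPoch-⊛-term-general (k ℕ.+ t) k (k ℕ.+ (t ℕ.+ t)) k (regroup k t) ℕ.≤-refl (ℕ.m≤m+n k (t ℕ.+ t)) (ℕ.m≤m+n k t)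
      (subst₂ (λ m w → suc (m ℕ.+ m) ≤ w ℕ.+ (suc k ℕ.+ suc k)) (ℕ.+-comm t k) (sym sqDist≡t²) (order-bound t k))
    where
    regroup : ∀ k t → k ℕ.+ (k ℕ.+ (t ℕ.+ t)) ≡ k ℕ.+ t ℕ.+ (k ℕ.+ t)
    regroup = solve-∀
    sqDist≡t² : sqDist (k ℕ.+ t) k ≡ t ℕ.* t
    sqDist≡t² rewrite ℕ.m≤n⇒m∸n≡0 (ℕ.m≤m+n k t) | ℕ.m+n∸m≡n k t = refl

  QPoch-⊛-term-above : ∀ t a → QPoch (t ℕ.+ a) ⊛ term (t ℕ.+ a) (t ℕ.+ a ℕ.+ t)
                               ≈[ suc ((t ℕ.+ a) ℕ.+ (t ℕ.+ a)) ] X (sqDist (t ℕ.+ a) (t ℕ.+ a ℕ.+ t))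
  QPoch-⊛-term-above t a =
    QPoch-⊛-term-general (t ℕ.+ a) (t ℕ.+ a ℕ.+ t) a a (regroup t a)
      (ℕ.≤-trans (ℕ.m≤n+m a t) (ℕ.m≤m+n (t ℕ.+ a) t)) ℕ.≤-refl (ℕ.m≤n+m a t)
      (subst (λ w → suc ((t ℕ.+ a) ℕ.+ (t ℕ.+ a)) ≤ w ℕ.+ (suc a ℕ.+ suc a)) (sym sqDist≡t²) (order-bound t a))
    where
    regroup : ∀ t a → t ℕ.+ a ℕ.+ t ℕ.+ a ≡ t ℕ.+ a ℕ.+ (t ℕ.+ a)
    regroup = solve-∀
    sqDist≡t² : sqDist (t ℕ.+ a) (t ℕ.+ a ℕ.+ t) ≡ t ℕ.* t
    sqDist≡t² rewrite ℕ.m+n∸m≡n (t ℕ.+ a) t | ℕ.m≤n⇒m∸n≡0 (ℕ.m≤m+n (t ℕ.+ a) t) = ℕ.+-identityʳ (t ℕ.* t)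

  QPoch-⊛-term : ∀ n k → k ≤ n ℕ.+ n → QPoch n ⊛ term n k ≈[ suc (n ℕ.+ n) ] X (sqDist n k)
  QPoch-⊛-term n k k≤2n with ℕ.≤-total k n
  ... | inj₁ k≤n = subst (λ n → QPoch n ⊛ term n k ≈[ suc (n ℕ.+ n) ] X (sqDist n k))
                         (ℕ.m+[n∸m]≡n k≤n) (QPoch-⊛-term-below k (n ∸ k))
  ... | inj₂ n≤k = subst₂ (λ n k → QPoch n ⊛ term n k ≈[ suc (n ℕ.+ n) ] X (sqDist n k))
                          t+a≡n t+a+t≡k (QPoch-⊛-term-above t (n ∸ t))
    where
    t : ℕ
    t = k ∸ n
    n+t≡k : n ℕ.+ t ≡ k
    n+t≡k = ℕ.m+[n∸m]≡n n≤k
    t≤n : t ≤ n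
    t≤n = ℕ.+-cancelˡ-≤ n t n (subst (_≤ n ℕ.+ n) (sym n+t≡k) k≤2n)
    t+a≡n : t ℕ.+ (n ∸ t) ≡ n
    t+a≡n = ℕ.m+[n∸m]≡n t≤n
    t+a+t≡k : t ℕ.+ (n ∸ t) ℕ.+ t ≡ k
    t+a+t≡k = trans (cong (ℕ._+ t) t+a≡n) n+t≡k

  squareSum : ℕ → Series
  squareSum n = altSum (λ k → X (sqDist n k)) (suc (n ℕ.+ n))

  QPoch-⊛-jacobiSum : ∀ n → QPoch n ⊛ jacobiSum n ≈[ suc (n ℕ.+ n) ] squareSum n
  QPoch-⊛-jacobiSum n = begin
    QPoch n ⊛ altSum (term n) L
      ≈⟨ ≈⇒≈[] L (≈-sym (altSum-⊛ (QPoch n) (term n) L)) ⟩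
    altSum (λ k → QPoch n ⊛ term n k) L
      ≈⟨ altSum-cong[] L L (λ k k<L → QPoch-⊛-term n k (ℕ.≤-pred k<L)) ⟩
    squareSum n ∎
    where
    L : ℕ
    L = suc (n ℕ.+ n)
    open ≈[]-Reasoning L

  signedSquares : ℕ → Series
  signedSquares zero    = 𝟘
  signedSquares (suc j) = signedSquares j ⊕ sign (suc j) ⊛ X (suc j ℕ.* suc j)

  -- Truncation of θ(-q) = Σ_{j ∈ ℤ} (-1)^j q^(j²).
  theta : ℕ → Series
  theta n = 𝟙 ⊕ const (+ 2) ⊛ signedSquares n

  sqDist-last : ∀ n → sqDist n (suc (n ℕ.+ n)) ≡ suc n ℕ.* suc n
  sqDist-last n = ℤ.+-injective (begin
    + sqDist n (suc (n ℕ.+ n))                           ≡⟨ sqDist-ℤ n (suc (n ℕ.+ n)) ⟩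
    (+ suc (n ℕ.+ n) - + n) * (+ suc (n ℕ.+ n) - + n)    ≡⟨ square-step (+ n) ⟩
    + suc n * + suc n                                    ≡⟨ ℤ.pos-* (suc n) (suc n) ⟨
    + (suc n ℕ.* suc n)                                  ∎)
    where
    open ≡-Reasoning
    square-step : ∀ N → (1ℤ + (N + N) - N) * (1ℤ + (N + N) - N) ≡ (1ℤ + N) * (1ℤ + N)
    square-step = ℤ-solve-∀

  squareSum-closed : ∀ n → squareSum n ≈ sign n ⊛ theta n
  squareSum-closed zero    = solve 0 (con 1ℤ :- con 0ℤ := con 1ℤ :* (con 1ℤ :+ con (+ 2) :* con 0ℤ)) ≈-refl
  squareSum-closed (suc n) = begin
    X m ⊖ altSum (λ k → X (sqDist n k)) (suc (n ℕ.+ suc n))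
      ≡⟨ cong (λ l → X m ⊖ altSum (λ k → X (sqDist n k)) (suc l)) (ℕ.+-suc n n) ⟩
    X m ⊖ altSum (λ k → X (sqDist n k)) (suc (suc (n ℕ.+ n)))
      ≈⟨ ⊕-congˡ (X m) (⊝-cong (altSum-snoc (λ k → X (sqDist n k)) (suc (n ℕ.+ n)))) ⟩
    X m ⊖ (squareSum n ⊕ ⊝ sign (n ℕ.+ n) ⊛ X (sqDist n (suc (n ℕ.+ n))))
      ≈⟨ ⊕-congˡ (X m) (⊝-cong (⊕-cong (squareSum-closed n)
                                        (⊛-cong (⊝-cong (sign-even n)) (λ i → cong (λ e → X e i) (sqDist-last n))))) ⟩
    X m ⊖ (s ⊛ theta n ⊕ ⊝ 𝟙 ⊛ X m)
      ≈⟨ solve 3 (λ s b x → x :- (s :* (con 1ℤ :+ con (+ 2) :* b) :+ (:- con 1ℤ) :* x)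
                            := con (+ 2) :* x :- s :* (con 1ℤ :+ con (+ 2) :* b))
                 ≈-refl s (signedSquares n) (X m) ⟩
    const (+ 2) ⊛ X m ⊖ s ⊛ theta n
      ≈⟨ ⊕-congʳ (⊝ (s ⊛ theta n)) (⊛-congˡ (≈-trans (≈-sym (⊛-identityˡ (X m))) (⊛-congʳ (≈-sym (sign-square n))))) ⟩
    const (+ 2) ⊛ ((s ⊛ s) ⊛ X m) ⊖ s ⊛ theta n
      ≈⟨ solve 3 (λ s b x → con (+ 2) :* ((s :* s) :* x) :- s :* (con 1ℤ :+ con (+ 2) :* b)
                            := (:- s) :* (con 1ℤ :+ con (+ 2) :* (b :+ (:- s) :* x)))
                 ≈-refl s (signedSquares n) (X m) ⟩
    ⊝ s ⊛ theta (suc n) ∎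
    where
    open ≈-Reasoning
    m : ℕ
    m = suc n ℕ.* suc n
    s : Series
    s = sign n

  QPoch-⊛-oddPoch² : ∀ n → QPoch n ⊛ (oddPoch n ⊛ oddPoch n) ≈[ suc (n ℕ.+ n) ] theta n
  QPoch-⊛-oddPoch² n = begin
    QPoch n ⊛ O²
      ≈⟨ ≈⇒≈[] L (≈-trans (≈-sym (⊛-identityˡ (QPoch n ⊛ O²))) (⊛-congʳ (≈-sym (sign-square n)))) ⟩
    (sign n ⊛ sign n) ⊛ (QPoch n ⊛ O²)
      ≈⟨ ≈⇒≈[] L (solve 3 (λ s p o → (s :* s) :* (p :* o) := s :* (p :* (s :* o))) ≈-refl (sign n) (QPoch n) O²) ⟩
    sign n ⊛ (QPoch n ⊛ (sign n ⊛ O²))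
      ≈⟨ ≈⇒≈[] L (⊛-congˡ (⊛-congˡ (≈-sym (jacobiSum-closed n)))) ⟩
    sign n ⊛ (QPoch n ⊛ jacobiSum n)
      ≈⟨ ⊛-cong[] L (≈[]-refl L) (QPoch-⊛-jacobiSum n) ⟩
    sign n ⊛ squareSum n
      ≈⟨ ≈⇒≈[] L (⊛-congˡ (squareSum-closed n)) ⟩
    sign n ⊛ (sign n ⊛ theta n)
      ≈⟨ ≈⇒≈[] L (≈-trans (≈-sym (⊛-assoc (sign n) (sign n) (theta n)))
                         (≈-trans (⊛-congʳ (sign-square n)) (⊛-identityˡ (theta n)))) ⟩
    theta n ∎
    where
    L : ℕ
    L = suc (n ℕ.+ n)
    O² : Series
    O² = oddPoch n ⊛ oddPoch n
    open ≈[]-Reasoning L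

module GaussIdentity where

  open import Data.Nat.Base as ℕ using (ℕ; zero; suc; _∸_; s≤s)
  import Data.Nat.Properties as ℕ
  open import Data.Integer.Base using (+_; 1ℤ)
  open import Relation.Binary.PropositionalEquality
  open import Defs
  open PowerSeries
  open Truncation
  open OverpartitionRecurrence using (ovp-stable)
  open OverpartitionSeries
  open GaussianBinomials
  open FiniteJacobiTripleProduct using (oddPoch; Xodd)
  open TruncatedTheta

  qPoch-even : ∀ n → qPoch (n ℕ.+ n) ≈ oddPoch n ⊛ QPoch n
  qPoch-even zero    = solve 0 (con 1ℤ := con 1ℤ :* con 1ℤ) ≈-refl
  qPoch-even (suc n) = begin
    qPoch (n ℕ.+ suc n) ⊛ (𝟙 ⊖ Q (suc n))
      ≡⟨ cong (λ m → qPoch m ⊛ (𝟙 ⊖ Q (suc n))) (ℕ.+-suc n n) ⟩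
    qPoch (n ℕ.+ n) ⊛ (𝟙 ⊖ Xodd n) ⊛ (𝟙 ⊖ Q (suc n))
      ≈⟨ ⊛-congʳ (⊛-congʳ (qPoch-even n)) ⟩
    oddPoch n ⊛ QPoch n ⊛ (𝟙 ⊖ Xodd n) ⊛ (𝟙 ⊖ Q (suc n))
      ≈⟨ solve 4 (λ o p x y → o :* p :* (con 1ℤ :- x) :* (con 1ℤ :- y) := o :* (con 1ℤ :- x) :* (p :* (con 1ℤ :- y)))
                 ≈-refl (oddPoch n) (QPoch n) (Xodd n) (Q (suc n)) ⟩
    oddPoch (suc n) ⊛ QPoch (suc n) ∎
    where open ≈-Reasoning

  qPoch-⊛-negqPoch : ∀ m → qPoch m ⊛ negqPoch m ≈ QPoch m
  qPoch-⊛-negqPoch zero    = solve 0 (con 1ℤ :* con 1ℤ := con 1ℤ) ≈-refl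
  qPoch-⊛-negqPoch (suc m) = begin
    qPoch m ⊛ (𝟙 ⊖ x) ⊛ (negqPoch m ⊛ (𝟙 ⊕ x))
      ≈⟨ solve 3 (λ p p′ x → p :* (con 1ℤ :- x) :* (p′ :* (con 1ℤ :+ x)) := (p :* p′) :* (con 1ℤ :- x :* x))
                 ≈-refl (qPoch m) (negqPoch m) x ⟩
    (qPoch m ⊛ negqPoch m) ⊛ (𝟙 ⊖ x ⊛ x)
      ≈⟨ ⊛-cong (qPoch-⊛-negqPoch m) (⊕-congˡ 𝟙 (⊝-cong (X-+ (suc m) (suc m)))) ⟩
    QPoch (suc m) ∎
    where
    open ≈-Reasoning
    x : Series
    x = X (suc m)

  qPoch-constant : ∀ r → qPoch r 0 ≡ 1ℤ
  qPoch-constant zero = refl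
  qPoch-constant (suc r) rewrite qPoch-constant r = refl

  oddPoch-⊛-negqPoch : ∀ n → oddPoch n ⊛ negqPoch (n ℕ.+ n) ≈[ suc (n ℕ.+ n) ] 𝟙
  oddPoch-⊛-negqPoch n = ⊛-cancelʳ[] (QPoch n) L (QPoch-constant n) (begin
    oddPoch n ⊛ E ⊛ QPoch n
      ≈⟨ ≈⇒≈[] L (solve 3 (λ o e p → o :* e :* p := (o :* p) :* e) ≈-refl (oddPoch n) E (QPoch n)) ⟩
    (oddPoch n ⊛ QPoch n) ⊛ E
      ≈⟨ ≈⇒≈[] L (⊛-congʳ (≈-sym (qPoch-even n))) ⟩
    qPoch (n ℕ.+ n) ⊛ E
      ≈⟨ ≈⇒≈[] L (qPoch-⊛-negqPoch (n ℕ.+ n)) ⟩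
    QPoch (n ℕ.+ n)
      ≈⟨ ≈[]-weaken (s≤s (ℕ.+-monoʳ-≤ n (ℕ.n≤1+n n))) (QPoch-stable (ℕ.m≤m+n n n)) ⟩
    QPoch n
      ≈⟨ ≈⇒≈[] L (≈-sym (⊛-identityˡ (QPoch n))) ⟩
    𝟙 ⊛ QPoch n ∎)
    where
    L : ℕ
    L = suc (n ℕ.+ n)
    E : Series
    E = negqPoch (n ℕ.+ n)
    open ≈[]-Reasoning L

  theta-⊛-negqPoch : ∀ n → theta n ⊛ negqPoch (n ℕ.+ n) ≈[ suc (n ℕ.+ n) ] qPoch (n ℕ.+ n)
  theta-⊛-negqPoch n = begin
    theta n ⊛ E
      ≈⟨ ⊛-cong[] L (≈[]-sym L (QPoch-⊛-oddPoch² n)) (≈[]-refl L) ⟩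
    QPoch n ⊛ (oddPoch n ⊛ oddPoch n) ⊛ E
      ≈⟨ ≈⇒≈[] L (solve 3 (λ p o e → p :* (o :* o) :* e := (o :* p) :* (o :* e)) ≈-refl (QPoch n) (oddPoch n) E) ⟩
    (oddPoch n ⊛ QPoch n) ⊛ (oddPoch n ⊛ E)
      ≈⟨ ⊛-cong[] L (≈[]-refl L) (oddPoch-⊛-negqPoch n) ⟩
    (oddPoch n ⊛ QPoch n) ⊛ 𝟙
      ≈⟨ ≈⇒≈[] L (≈-trans (⊛-comm (oddPoch n ⊛ QPoch n) 𝟙) (⊛-identityˡ (oddPoch n ⊛ QPoch n))) ⟩
    oddPoch n ⊛ QPoch n
      ≈⟨ ≈⇒≈[] L (≈-sym (qPoch-even n)) ⟩
    qPoch (n ℕ.+ n) ∎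
    where
    L : ℕ
    L = suc (n ℕ.+ n)
    E : Series
    E = negqPoch (n ℕ.+ n)
    open ≈[]-Reasoning L

  theta-⊛-ovpSeries : ∀ n → theta n ⊛ ovpSeries (n ℕ.+ n) ≈[ suc (n ℕ.+ n) ] 𝟙
  theta-⊛-ovpSeries n = ⊛-cancelʳ[] (qPoch (n ℕ.+ n)) L (qPoch-constant (n ℕ.+ n)) (begin
    theta n ⊛ ovpSeries (n ℕ.+ n) ⊛ qPoch (n ℕ.+ n)
      ≈⟨ ≈⇒≈[] L (⊛-assoc (theta n) (ovpSeries (n ℕ.+ n)) (qPoch (n ℕ.+ n))) ⟩
    theta n ⊛ (ovpSeries (n ℕ.+ n) ⊛ qPoch (n ℕ.+ n))
      ≈⟨ ≈⇒≈[] L (⊛-congˡ (ovpSeries-⊛-qPoch (n ℕ.+ n))) ⟩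
    theta n ⊛ negqPoch (n ℕ.+ n)
      ≈⟨ theta-⊛-negqPoch n ⟩
    qPoch (n ℕ.+ n)
      ≈⟨ ≈⇒≈[] L (≈-sym (⊛-identityˡ (qPoch (n ℕ.+ n)))) ⟩
    𝟙 ⊛ qPoch (n ℕ.+ n) ∎)
    where
    L : ℕ
    L = suc (n ℕ.+ n)
    open ≈[]-Reasoning L

  ovpSeries-≈[]-overlinepSeries : ∀ k → ovpSeries k ≈[ suc k ] overlinepSeries
  ovpSeries-≈[]-overlinepSeries k i i<1+k =
    cong +_ (trans (cong (λ k → ovp k i) (sym (ℕ.m∸n+n≡m (ℕ.≤-pred i<1+k)))) (ovp-stable (k ∸ i) i))

  theta-⊛-overlinepSeries : ∀ n → theta n ⊛ overlinepSeries ≈[ suc (n ℕ.+ n) ] 𝟙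
  theta-⊛-overlinepSeries n =
    ≈[]-trans L (⊛-cong[] L (≈[]-refl L) (≈[]-sym L (ovpSeries-≈[]-overlinepSeries (n ℕ.+ n))))
                (theta-⊛-ovpSeries n)
    where L = suc (n ℕ.+ n)

module OverpartitionTriples where

  open import Data.Nat.Base as ℕ using (ℕ; zero; suc; _∸_)
  import Data.Nat.Properties as ℕ
  open import Data.Nat.ListAction using (sum)
  open import Data.Integer.Base using (+_)
  import Data.Integer.Properties as ℤ
  open import Data.List.Base using (applyUpTo; map; upTo)
  open import Data.List.Properties using (map-applyUpTo)
  open import Function.Base using (id)
  open import Relation.Binary.PropositionalEquality
  open import Defs
  open PowerSeries
  open ApplyUpToSums using (sum-applyUpTo-cong; sum-applyUpTo-scale)
  open OverpartitionSeries using (overlinepSeries)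

  lift : (ℕ → ℕ) → Series
  lift f n = + f n

  lift-convolution : ∀ f g n → + sum (applyUpTo (λ i → f i ℕ.* g (n ∸ i)) (suc n)) ≡ (lift f ⊛ lift g) n
  lift-convolution f g zero    = trans (cong +_ (ℕ.+-identityʳ (f 0 ℕ.* g 0))) (ℤ.pos-* (f 0) (g 0))
  lift-convolution f g (suc n) =
    trans (ℤ.pos-+ (f 0 ℕ.* g (suc n)) _)
          (cong₂ Data.Integer.Base._+_ (ℤ.pos-* (f 0) (g (suc n))) (lift-convolution (λ i → f (suc i)) g n))

  overlinep2 : ℕ → ℕ
  overlinep2 m = sum (applyUpTo (λ b → overlinep b ℕ.* overlinep (m ∸ b)) (suc m))

  overlinep3-convolution : ∀ N → overlinep3 N ≡ sum (applyUpTo (λ a → overlinep a ℕ.* overlinep2 (N ∸ a)) (suc N))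
  overlinep3-convolution N = begin
    overlinep3 N
      ≡⟨ cong sum (map-applyUpTo id inner (suc N)) ⟩
    sum (applyUpTo inner (suc N))
      ≡⟨ sum-applyUpTo-cong inner _ (suc N) (λ a _ → inner≡ a) ⟩
    sum (applyUpTo (λ a → overlinep a ℕ.* overlinep2 (N ∸ a)) (suc N)) ∎
    where
    open ≡-Reasoning
    inner : ℕ → ℕ
    inner a = sum (map (λ b → overlinep a ℕ.* overlinep b ℕ.* overlinep (N ∸ a ∸ b)) (upTo (suc (N ∸ a))))
    inner≡ : ∀ a → inner a ≡ overlinep a ℕ.* overlinep2 (N ∸ a)
    inner≡ a = begin
      inner a
        ≡⟨ cong sum (map-applyUpTo id (λ b → overlinep a ℕ.* overlinep b ℕ.* overlinep (N ∸ a ∸ b)) (suc (N ∸ a))) ⟩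
      sum (applyUpTo (λ b → overlinep a ℕ.* overlinep b ℕ.* overlinep (N ∸ a ∸ b)) (suc (N ∸ a)))
        ≡⟨ sum-applyUpTo-cong _ (λ b → overlinep a ℕ.* (overlinep b ℕ.* overlinep (N ∸ a ∸ b))) (suc (N ∸ a))
             (λ b _ → ℕ.*-assoc (overlinep a) (overlinep b) (overlinep (N ∸ a ∸ b))) ⟩
      sum (applyUpTo (λ b → overlinep a ℕ.* (overlinep b ℕ.* overlinep (N ∸ a ∸ b))) (suc (N ∸ a)))
        ≡⟨ sum-applyUpTo-scale (overlinep a) (λ b → overlinep b ℕ.* overlinep (N ∸ a ∸ b)) (suc (N ∸ a)) ⟩
      overlinep a ℕ.* overlinep2 (N ∸ a) ∎

  overlinep3-series : ∀ N → + overlinep3 N ≡ (overlinepSeries ^ 3) N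
  overlinep3-series N = begin
    + overlinep3 N
      ≡⟨ cong +_ (overlinep3-convolution N) ⟩
    + sum (applyUpTo (λ a → overlinep a ℕ.* overlinep2 (N ∸ a)) (suc N))
      ≡⟨ lift-convolution overlinep overlinep2 N ⟩
    (overlinepSeries ⊛ lift overlinep2) N
      ≡⟨ ⊛-congˡ (lift-convolution overlinep overlinep) N ⟩
    (overlinepSeries ⊛ (overlinepSeries ⊛ overlinepSeries)) N
      ≡⟨ solve 1 (λ p → p :* (p :* p) := p :^ 3) ≈-refl overlinepSeries N ⟩
    (overlinepSeries ^ 3) N ∎
    where open ≡-Reasoning

module CubeModSixteen where

  open import Data.Nat.Base as ℕ using (ℕ; zero; suc)
  open import Data.Integer.Base using (+_; 0ℤ; 1ℤ)
  open import Data.Product.Base using (Σ; _,_)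
  open PowerSeries
  open Truncation
  open OverpartitionSeries using (overlinepSeries)
  open AlternatingSums using (sign; sign-square)
  open TruncatedTheta using (signedSquares; theta)
  open GaussIdentity using (theta-⊛-overlinepSeries)

  -- U b inverts 1 + 2b up to 16b⁴, so (1 + 2b)³ U b³ = 1 - 16 R₁ b.
  U R₁ R₂ : Series → Series
  U b = 𝟙 ⊖ const (+ 2) ⊛ b ⊕ const (+ 4) ⊛ b ^ 2 ⊖ const (+ 8) ⊛ b ^ 3
  R₁ b = const (+ 3) ⊛ b ^ 4 ⊖ const (+ 48) ⊛ b ^ 8 ⊕ const (+ 256) ⊛ b ^ 12
  R₂ b = b ^ 2 ⊖ const (+ 5) ⊛ b ^ 3 ⊕ const (+ 12) ⊛ b ^ 4 ⊖ const (+ 24) ⊛ b ^ 5 ⊕ const (+ 40) ⊛ b ^ 6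
         ⊖ const (+ 48) ⊛ b ^ 7 ⊕ const (+ 48) ⊛ b ^ 8 ⊖ const (+ 32) ⊛ b ^ 9

  cube-split : ∀ p b → p ^ 3 ≈ const (+ 16) ⊛ (p ^ 3 ⊛ R₁ b) ⊕ ((𝟙 ⊕ const (+ 2) ⊛ b) ⊛ p) ^ 3 ⊛ U b ^ 3
  cube-split = solve 2 (λ p b →
    p :^ 3 := con (+ 16) :* (p :^ 3 :* (con (+ 3) :* b :^ 4 :- con (+ 48) :* b :^ 8 :+ con (+ 256) :* b :^ 12))
              :+ ((con 1ℤ :+ con (+ 2) :* b) :* p) :^ 3
                 :* (con 1ℤ :- con (+ 2) :* b :+ con (+ 4) :* b :^ 2 :- con (+ 8) :* b :^ 3) :^ 3) ≈-refl

  U-cube : ∀ b → U b ^ 3 ≈ 𝟙 ⊖ const (+ 6) ⊛ b ⊕ const (+ 8) ⊛ (b ⊛ b) ⊕ const (+ 16) ⊛ R₂ b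
  U-cube = solve 1 (λ b →
    (con 1ℤ :- con (+ 2) :* b :+ con (+ 4) :* b :^ 2 :- con (+ 8) :* b :^ 3) :^ 3
    := con 1ℤ :- con (+ 6) :* b :+ con (+ 8) :* (b :* b)
       :+ con (+ 16) :* (b :^ 2 :- con (+ 5) :* b :^ 3 :+ con (+ 12) :* b :^ 4 :- con (+ 24) :* b :^ 5
                         :+ con (+ 40) :* b :^ 6 :- con (+ 48) :* b :^ 7 :+ con (+ 48) :* b :^ 8
                         :- con (+ 32) :* b :^ 9)) ≈-refl

  doubleSquares : ℕ → Series
  doubleSquares zero    = 𝟘
  doubleSquares (suc j) = doubleSquares j ⊕ X (suc j ℕ.* suc j ℕ.+ suc j ℕ.* suc j)

  crossTerms : ℕ → Series
  crossTerms zero    = 𝟘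
  crossTerms (suc j) = crossTerms j ⊕ sign (suc j) ⊛ X (suc j ℕ.* suc j) ⊛ signedSquares j

  signedSquares-square : ∀ j → signedSquares j ⊛ signedSquares j ≈ doubleSquares j ⊕ const (+ 2) ⊛ crossTerms j
  signedSquares-square zero    = solve 0 (con 0ℤ :* con 0ℤ := con 0ℤ :+ con (+ 2) :* con 0ℤ) ≈-refl
  signedSquares-square (suc j) = begin
    (b ⊕ s ⊛ x) ⊛ (b ⊕ s ⊛ x)
      ≈⟨ solve 3 (λ b s x → (b :+ s :* x) :* (b :+ s :* x) := b :* b :+ (s :* s) :* (x :* x) :+ con (+ 2) :* (s :* x :* b))
                 ≈-refl b s x ⟩
    b ⊛ b ⊕ (s ⊛ s) ⊛ (x ⊛ x) ⊕ const (+ 2) ⊛ (s ⊛ x ⊛ b)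
      ≈⟨ ⊕-congʳ (const (+ 2) ⊛ (s ⊛ x ⊛ b))
           (⊕-cong (signedSquares-square j) (≈-trans (⊛-cong (sign-square (suc j)) (X-+ m m)) (⊛-identityˡ (X (m ℕ.+ m))))) ⟩
    doubleSquares j ⊕ const (+ 2) ⊛ crossTerms j ⊕ X (m ℕ.+ m) ⊕ const (+ 2) ⊛ (s ⊛ x ⊛ b)
      ≈⟨ solve 4 (λ a c y z → a :+ con (+ 2) :* c :+ y :+ con (+ 2) :* z := a :+ y :+ con (+ 2) :* (c :+ z))
                 ≈-refl (doubleSquares j) (crossTerms j) (X (m ℕ.+ m)) (s ⊛ x ⊛ b) ⟩
    doubleSquares (suc j) ⊕ const (+ 2) ⊛ crossTerms (suc j) ∎
    where
    open ≈-Reasoning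
    m : ℕ
    m = suc j ℕ.* suc j
    b s x : Series
    b = signedSquares j
    s = sign (suc j)
    x = X m

  overlinepSeries-cube-mod-16 : ∀ J → Σ Series λ h →
    overlinepSeries ^ 3 ≈[ suc (J ℕ.+ J) ]
      𝟙 ⊖ const (+ 6) ⊛ signedSquares J ⊕ const (+ 8) ⊛ doubleSquares J ⊕ const (+ 16) ⊛ h
  overlinepSeries-cube-mod-16 J = P ^ 3 ⊛ R₁ b ⊕ R₂ b ⊕ crossTerms J , (begin
    P ^ 3
      ≈⟨ ≈⇒≈[] L (cube-split P b) ⟩
    const (+ 16) ⊛ (P ^ 3 ⊛ R₁ b) ⊕ (theta J ⊛ P) ^ 3 ⊛ U b ^ 3
      ≈⟨ ⊕-cong[] L (≈[]-refl {const (+ 16) ⊛ (P ^ 3 ⊛ R₁ b)} L)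
                    (⊛-cong[] L (^-cong[] 3 (theta-⊛-overlinepSeries J)) (≈[]-refl L)) ⟩
    const (+ 16) ⊛ (P ^ 3 ⊛ R₁ b) ⊕ 𝟙 ^ 3 ⊛ U b ^ 3
      ≈⟨ ≈⇒≈[] L (⊕-congˡ (const (+ 16) ⊛ (P ^ 3 ⊛ R₁ b))
                   (⊛-congˡ (≈-trans (U-cube b) (⊕-congʳ (const (+ 16) ⊛ R₂ b) (⊕-congˡ (𝟙 ⊖ const (+ 6) ⊛ b)
                     (⊛-congˡ (signedSquares-square J))))))) ⟩
    const (+ 16) ⊛ (P ^ 3 ⊛ R₁ b) ⊕ 𝟙 ^ 3 ⊛ (𝟙 ⊖ const (+ 6) ⊛ b ⊕ const (+ 8) ⊛ (S ⊕ const (+ 2) ⊛ C) ⊕ const (+ 16) ⊛ R₂ b)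
      ≈⟨ ≈⇒≈[] L (solve 5 (λ g b s c r →
                   con (+ 16) :* g :+ con 1ℤ :^ 3 :* (con 1ℤ :- con (+ 6) :* b :+ con (+ 8) :* (s :+ con (+ 2) :* c) :+ con (+ 16) :* r)
                   := con 1ℤ :- con (+ 6) :* b :+ con (+ 8) :* s :+ con (+ 16) :* (g :+ r :+ c))
                   ≈-refl (P ^ 3 ⊛ R₁ b) b S C (R₂ b)) ⟩
    𝟙 ⊖ const (+ 6) ⊛ b ⊕ const (+ 8) ⊛ S ⊕ const (+ 16) ⊛ (P ^ 3 ⊛ R₁ b ⊕ R₂ b ⊕ C) ∎)
    where
    P b S C : Series
    P = overlinepSeries
    b = signedSquares J
    S = doubleSquares J
    C = crossTerms J
    L : ℕ
    L = suc (J ℕ.+ J)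
    open ≈[]-Reasoning L
    ^-cong[] : ∀ {f g} n → f ≈[ L ] g → f ^ n ≈[ L ] g ^ n
    ^-cong[] zero    _   = ≈[]-refl L
    ^-cong[] (suc n) f≈g = ⊛-cong[] L f≈g (^-cong[] n f≈g)

module SquaresModEight where

  open import Data.Nat.Base using (ℕ; suc; _+_; _*_; _%_; _<_; _≡ᵇ_; s≤s)
  open import Data.Nat.DivMod using (%-distribˡ-*; %-distribˡ-+; m%n<n; [m+kn]%n≡m%n)
  open import Data.Nat.Properties using (+-comm; *-comm)
  open import Data.Bool.Base using (Bool; T; _∨_)
  open import Data.Unit.Base using (tt)
  open import Relation.Nullary.Negation.Core using (¬_)
  open import Relation.Binary.PropositionalEquality

  squareResidue : ℕ → Bool
  squareResidue r = (r ≡ᵇ 0) ∨ (r ≡ᵇ 1) ∨ (r ≡ᵇ 4)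

  twiceSquareResidue : ℕ → Bool
  twiceSquareResidue r = (r ≡ᵇ 0) ∨ (r ≡ᵇ 2)

  square-residue : ∀ t → T (squareResidue (t * t % 8))
  square-residue t =
    subst (λ m → T (squareResidue m)) (sym (%-distribˡ-* t t 8)) (check (t % 8) (m%n<n t 8))
    where
    check : ∀ s → s < 8 → T (squareResidue (s * s % 8))
    check 0 _ = tt
    check 1 _ = tt
    check 2 _ = tt
    check 3 _ = tt
    check 4 _ = tt
    check 5 _ = tt
    check 6 _ = tt
    check 7 _ = tt
    check (suc (suc (suc (suc (suc (suc (suc (suc _)))))))) (s≤s (s≤s (s≤s (s≤s (s≤s (s≤s (s≤s (s≤s ()))))))))

  twiceSquare-residue : ∀ t → T (twiceSquareResidue ((t * t + t * t) % 8))
  twiceSquare-residue t =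
    subst (λ m → T (twiceSquareResidue m))
          (sym (trans (%-distribˡ-+ (t * t) (t * t) 8) (cong (λ m → (m + m) % 8) (%-distribˡ-* t t 8))))
          (check (t % 8) (m%n<n t 8))
    where
    check : ∀ s → s < 8 → T (twiceSquareResidue ((s * s % 8 + s * s % 8) % 8))
    check 0 _ = tt
    check 1 _ = tt
    check 2 _ = tt
    check 3 _ = tt
    check 4 _ = tt
    check 5 _ = tt
    check 6 _ = tt
    check 7 _ = tt
    check (suc (suc (suc (suc (suc (suc (suc (suc _)))))))) (s≤s (s≤s (s≤s (s≤s (s≤s (s≤s (s≤s (s≤s ()))))))))

  8n+r%8 : ∀ n r → (8 * n + r) % 8 ≡ r % 8
  8n+r%8 n r = trans (cong (_% 8) (trans (+-comm (8 * n) r) (cong (r +_) (*-comm 8 n)))) ([m+kn]%n≡m%n r n 8)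

  square≢8n+r : ∀ n r → ¬ T (squareResidue (r % 8)) → ∀ t → t * t ≢ 8 * n + r
  square≢8n+r n r r-nonresidue t t²≡8n+r =
    r-nonresidue (subst (λ m → T (squareResidue m)) (trans (cong (_% 8) t²≡8n+r) (8n+r%8 n r)) (square-residue t))

  twiceSquare≢8n+r : ∀ n r → ¬ T (twiceSquareResidue (r % 8)) → ∀ t → t * t + t * t ≢ 8 * n + r
  twiceSquare≢8n+r n r r-nonresidue t 2t²≡8n+r =
    r-nonresidue (subst (λ m → T (twiceSquareResidue m)) (trans (cong (_% 8) 2t²≡8n+r) (8n+r%8 n r))
                        (twiceSquare-residue t))

module OverpartitionTripleCongruences where

  open import Data.Nat.Base as ℕ using (zero; suc; _<_; s≤s)
  import Data.Nat.Properties as ℕ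
  open import Data.Nat.Divisibility using (_∣_; divides)
  open import Data.Integer.Base using (ℤ; +_; 0ℤ; _+_; _*_; -_; ∣_∣)
  import Data.Integer.Properties as ℤ
  open import Data.Integer.Tactic.RingSolver using () renaming (solve-∀ to ℤ-solve-∀)
  open import Data.Product.Base using (Σ; _,_; proj₁; proj₂)
  open import Relation.Nullary.Negation.Core using (contradiction)
  open import Relation.Binary.PropositionalEquality
  open import Defs
  open PowerSeries
  open AlternatingSums using (sign; sign-tail)
  open TruncatedTheta using (signedSquares)
  open CubeModSixteen using (doubleSquares; overlinepSeries-cube-mod-16)
  open OverpartitionSeries using (overlinepSeries)
  open OverpartitionTriples using (overlinep3-series)

  shift-constant-≢ : ∀ m f {N} → (∀ i → f (suc i) ≡ 0ℤ) → m ≢ N → shift m f N ≡ 0ℤ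
  shift-constant-≢ zero    f {zero}  _     m≢N = contradiction refl m≢N
  shift-constant-≢ zero    f {suc N} f-tail _  = f-tail N
  shift-constant-≢ (suc m) f {zero}  _      _  = refl
  shift-constant-≢ (suc m) f {suc N} f-tail m≢N = shift-constant-≢ m f f-tail (λ m≡N → m≢N (cong suc m≡N))

  signedSquares-vanish : ∀ J N → (∀ t → suc t ℕ.* suc t ≢ N) → signedSquares J N ≡ 0ℤ
  signedSquares-vanish zero    N _ = 𝟘-coeff N
  signedSquares-vanish (suc j) N nonsquare
    rewrite signedSquares-vanish j N nonsquare
          | ⊛-comm (sign (suc j)) (X (suc j ℕ.* suc j)) N
          | X-⊛ (suc j ℕ.* suc j) (sign (suc j)) N
          | shift-constant-≢ (suc j ℕ.* suc j) (sign (suc j)) (sign-tail (suc j)) (nonsquare j) = refl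

  doubleSquares-vanish : ∀ J N → (∀ t → suc t ℕ.* suc t ℕ.+ suc t ℕ.* suc t ≢ N) → doubleSquares J N ≡ 0ℤ
  doubleSquares-vanish zero    N _ = 𝟘-coeff N
  doubleSquares-vanish (suc j) N nontwice
    rewrite doubleSquares-vanish j N nontwice
          | shift-constant-≢ (suc j ℕ.* suc j ℕ.+ suc j ℕ.* suc j) 𝟙 (λ _ → refl) (nontwice j) = refl

  const-⊛-coeff : ∀ c f n → (const c ⊛ f) n ≡ c * f n
  const-⊛-coeff c f zero    = refl
  const-⊛-coeff c f (suc n) rewrite ⊛-vanishˡ {tail (const c)} f n (λ _ _ → refl) = ℤ.+-identityʳ (c * f (suc n))

  𝟙-coeff-pos : ∀ {N} → 0 < N → 𝟙 N ≡ 0ℤ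
  𝟙-coeff-pos (s≤s _) = refl

  overlinep3-mod-16 : ∀ N → 0 < N → Σ ℤ λ y →
    + overlinep3 N ≡ - (+ 6 * signedSquares N N) + + 8 * doubleSquares N N + + 16 * y
  overlinep3-mod-16 N 0<N = h N , (begin
    + overlinep3 N
      ≡⟨ overlinep3-series N ⟩
    (overlinepSeries ^ 3) N
      ≡⟨ proj₂ (overlinepSeries-cube-mod-16 N) N (s≤s (ℕ.m≤m+n N N)) ⟩
    𝟙 N + - (const (+ 6) ⊛ b) N + (const (+ 8) ⊛ S) N + (const (+ 16) ⊛ h) N
      ≡⟨ cong₂ _+_ (cong₂ _+_ (cong₂ _+_ (𝟙-coeff-pos 0<N) (cong -_ (const-⊛-coeff (+ 6) b N)))
                               (const-⊛-coeff (+ 8) S N))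
                   (const-⊛-coeff (+ 16) h N) ⟩
    0ℤ + - (+ 6 * b N) + + 8 * S N + + 16 * h N
      ≡⟨ cong (λ z → z + + 8 * S N + + 16 * h N) (ℤ.+-identityˡ (- (+ 6 * b N))) ⟩
    - (+ 6 * b N) + + 8 * S N + + 16 * h N ∎)
    where
    open ≡-Reasoning
    b S h : Series
    b = signedSquares N
    S = doubleSquares N
    h = proj₁ (overlinepSeries-cube-mod-16 N)

  ∣-from-ℤ : ∀ {x k} z → + x ≡ + k * z → k ∣ x
  ∣-from-ℤ {k = k} z eq = divides ∣ z ∣ (trans (cong ∣_∣ eq) (trans (ℤ.abs-* (+ k) z) (ℕ.*-comm k ∣ z ∣)))

  2∣overlinep3 : ∀ N → 0 < N → 2 ∣ overlinep3 N
  2∣overlinep3 N 0<N = ∣-from-ℤ (- (+ 3 * b) + + 4 * s + + 8 * y) (trans eq (factor b s y))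
    where
    b s y : ℤ
    b = signedSquares N N
    s = doubleSquares N N
    y = proj₁ (overlinep3-mod-16 N 0<N)
    eq : + overlinep3 N ≡ - (+ 6 * b) + + 8 * s + + 16 * y
    eq = proj₂ (overlinep3-mod-16 N 0<N)
    factor : ∀ b s y → - (+ 6 * b) + + 8 * s + + 16 * y ≡ + 2 * (- (+ 3 * b) + + 4 * s + + 8 * y)
    factor = ℤ-solve-∀

  8∣overlinep3 : ∀ N → 0 < N → (∀ t → suc t ℕ.* suc t ≢ N) → 8 ∣ overlinep3 N
  8∣overlinep3 N 0<N nonsquare = ∣-from-ℤ (s + + 2 * y) (begin
    + overlinep3 N                                      ≡⟨ proj₂ (overlinep3-mod-16 N 0<N) ⟩
    - (+ 6 * signedSquares N N) + + 8 * s + + 16 * y    ≡⟨ cong (λ b → - (+ 6 * b) + + 8 * s + + 16 * y) b≡0 ⟩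
    - (+ 6 * 0ℤ) + + 8 * s + + 16 * y                   ≡⟨ factor s y ⟩
    + 8 * (s + + 2 * y)                                 ∎)
    where
    open ≡-Reasoning
    s y : ℤ
    s = doubleSquares N N
    y = proj₁ (overlinep3-mod-16 N 0<N)
    b≡0 : signedSquares N N ≡ 0ℤ
    b≡0 = signedSquares-vanish N N nonsquare
    factor : ∀ s y → - (+ 6 * 0ℤ) + + 8 * s + + 16 * y ≡ + 8 * (s + + 2 * y)
    factor = ℤ-solve-∀

  16∣overlinep3 : ∀ N → 0 < N → (∀ t → suc t ℕ.* suc t ≢ N) → (∀ t → suc t ℕ.* suc t ℕ.+ suc t ℕ.* suc t ≢ N) →
                  16 ∣ overlinep3 N
  16∣overlinep3 N 0<N nonsquare nontwice = ∣-from-ℤ y (begin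
    + overlinep3 N
      ≡⟨ proj₂ (overlinep3-mod-16 N 0<N) ⟩
    - (+ 6 * signedSquares N N) + + 8 * doubleSquares N N + + 16 * y
      ≡⟨ cong₂ (λ b s → - (+ 6 * b) + + 8 * s + + 16 * y) (signedSquares-vanish N N nonsquare)
                                                           (doubleSquares-vanish N N nontwice) ⟩
    - (+ 6 * 0ℤ) + + 8 * 0ℤ + + 16 * y
      ≡⟨ factor y ⟩
    + 16 * y ∎)
    where
    open ≡-Reasoning
    y : ℤ
    y = proj₁ (overlinep3-mod-16 N 0<N)
    factor : ∀ y → - (+ 6 * 0ℤ) + + 8 * 0ℤ + + 16 * y ≡ + 16 * y
    factor = ℤ-solve-∀

open import Defs
open import Data.Nat using (ℕ; suc; _+_; _*_; _%_; _<_; z≤n; s≤s)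
open import Data.Nat.Properties using (≤-trans; m≤n+m)
open import Data.Nat.Divisibility using (_∣_)
open import Data.Product using (_×_; _,_)
open import Data.Bool using (T)
open import Relation.Nullary using (¬_)
open import Relation.Binary.PropositionalEquality using (_≢_)
open SquaresModEight using (squareResidue; twiceSquareResidue; square≢8n+r; twiceSquare≢8n+r)
open OverpartitionTripleCongruences using (2∣overlinep3; 8∣overlinep3; 16∣overlinep3)

corollary2p4 : (n : ℕ) →
    (2 ∣ overlinep3 (8 * n + 1)) × (8 ∣ overlinep3 (8 * n + 2)) ×
    (16 ∣ overlinep3 (8 * n + 3)) × (2 ∣ overlinep3 (8 * n + 4)) ×
    (16 ∣ overlinep3 (8 * n + 5)) × (16 ∣ overlinep3 (8 * n + 6))
corollary2p4 n =
  2∣overlinep3 (8 * n + 1) (positive 0) ,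
  8∣overlinep3 (8 * n + 2) (positive 1) (nonsquare 2 (λ ())) ,
  16∣overlinep3 (8 * n + 3) (positive 2) (nonsquare 3 (λ ())) (nontwice 3 (λ ())) ,
  2∣overlinep3 (8 * n + 4) (positive 3) ,
  16∣overlinep3 (8 * n + 5) (positive 4) (nonsquare 5 (λ ())) (nontwice 5 (λ ())) ,
  16∣overlinep3 (8 * n + 6) (positive 5) (nonsquare 6 (λ ())) (nontwice 6 (λ ()))
  where
  positive : ∀ r → 0 < 8 * n + suc r
  positive r = ≤-trans (s≤s z≤n) (m≤n+m (suc r) (8 * n))
  nonsquare : ∀ r → ¬ T (squareResidue (r % 8)) → ∀ t → suc t * suc t ≢ 8 * n + r
  nonsquare r r-nonresidue t = square≢8n+r n r r-nonresidue (suc t)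
  nontwice : ∀ r → ¬ T (twiceSquareResidue (r % 8)) → ∀ t → suc t * suc t + suc t * suc t ≢ 8 * n + r
  nontwice r r-nonresidue t = twiceSquare≢8n+r n r r-nonresidue (suc t)
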